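{- Let $p$ be a prime and let $q=p^\ell$ where $\ell>1$ is an integer. Let $\mathcal{B}\subset\mathbb{Z}_q$ be such that the reduction of $\mathcal{B}$ modulo $p$ has at least $5\lceil 2\sqrt{p}\rceil+2$ elements. Moreover, let $a_0\in\mathbb{Z}_q$. Then there exists $\mathcal{A}\subset\mathcal{B}$ with \[ a_0+\Sigma(\mathcal{A})\equiv 0 \pmod p \quad\text{and}\quad a_0+\Sigma(\mathcal{A})\not\equiv 0\pmod q. \]
   Context: $\mathbb{Z}_q$ denotes $\mathbb{Z}/q\mathbb{Z}$; reduction modulo $p$ of elements of $\mathbb{Z}_q$ is the natural map $\mathbb{Z}_q\to\mathbb{Z}_p$. For a finite set $\mathcal{A}$, $\Sigma(\mathcal{A})=\sum_{a\in\mathcal{A}}a$. $\lceil x\rceil$ is the smallest integer at least $x$. -}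

module Defs where

open import Data.Nat using (ℕ; zero; suc; _+_; _%_; _≡ᵇ_; NonZero)
open import Data.Bool using (Bool; true; false; _∧_; _∨_)
open import Data.Fin using (Fin; toℕ)
open import Data.Fin.Subset using (Subset; inside; outside)
open import Data.Vec using ([]; _∷_; tabulate; lookup)

-- Elements of ℤ_n are represented by Fin n (representatives 0,…,n-1);
-- subsets of ℤ_n are 'Subset n' from Data.Fin.Subset (inside = member).

-- Σ(A) computed on the representatives, as a natural number
-- (to be reduced modulo q or p):  sumℕ A = Σ_{i ∈ A} toℕ i.
sumFrom : ∀ {m} → ℕ → Subset m → ℕ
sumFrom off [] = 0
sumFrom off (inside ∷ t) = off + sumFrom (suc off) t
sumFrom off (outside ∷ t) = sumFrom (suc off) t

sumℕ : ∀ {n} → Subset n → ℕ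
sumℕ = sumFrom 0

anyIn : ∀ {m} → (Fin m → Bool) → Subset m → Bool
anyIn f [] = false
anyIn f (inside ∷ t) = f Fin.zero ∨ anyIn (λ i → f (Fin.suc i)) t
  where import Data.Fin as Fin
anyIn f (outside ∷ t) = anyIn (λ i → f (Data.Fin.suc i)) t

reduceMod : ∀ {q} (p : ℕ) .{{_ : NonZero p}} → Subset q → Subset p
reduceMod p B = tabulate λ r → toSide (anyIn (λ b → (toℕ b % p) ≡ᵇ toℕ r) B)
  where
  toSide : Bool → Data.Fin.Subset.Side
  toSide true = inside
  toSide false = outside

-- Let R be the nonzero residues of B, each with a fixed representative in B.  Subset sums of R are
-- built greedily, always adding the residue a that enlarges the current set X of reachable sums the
-- most.  Cauchy–Davenport applied to the iterated sums of R ∪ {0}, together with a second-moment count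
-- of the overlaps |X ∩ (X − b)|, shows that such a step adds at least half of min(|X|, p − |X|) when this
-- is small compared with the number r of unused residues, and at least r/8 otherwise.  So X first grows
-- geometrically, then by r/8 per step, and at the end the missing part halves with every step: about
-- 5√p residues reach every residue mod p.
-- Take two disjoint such sets C, D and one more residue d.  Completing any E ⊆ D ∪ {d} by a subset of C
-- gives A with a₀ + Σ(A) ≡ 0 (mod p).  If all of these were ≡ 0 (mod q), Σ(E) mod q would depend only on
-- Σ(E) mod p.  For subsets Mⱼ of D with Σ(Mⱼ) ≡ j·d (mod p), Mⱼ ∪ {d} has the residue of Mⱼ₊₁, hence
-- Σ(Mⱼ₊₁) ≡ Σ(Mⱼ) + d̃ (mod q) for the representative d̃ of d; as M_p = M₀ this forces p·d̃ ≡ 0 (mod q),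
-- impossible since q = p^ℓ with ℓ ≥ 2 and p ∤ d̃.

module Submission where

open import Defs
open import Data.Nat using (ℕ; _+_; _*_; _^_; _%_; _≤_; _<_; NonZero)
open import Data.Nat.Primality using (Prime)
open import Data.Fin using (Fin; toℕ)
open import Data.Fin.Subset using (Subset; _⊆_; ∣_∣)
open import Data.Product using (∃; _×_)
open import Relation.Binary.PropositionalEquality using (_≡_; _≢_)

open import Data.Bool using (Bool; true; false; not; _∧_; _∨_) renaming (_≟_ to _≟ᵇ_)
open import Data.Bool.ListAction using (any)
open import Data.Bool.Properties using (T-≡; ∧-zeroʳ; ∧-identityʳ; ∧-comm; ∧-inverseʳ; ∧-conicalˡ; ∧-conicalʳ; ∨-zeroʳ; not-involutive; not-injective)
open import Data.Empty using (⊥; ⊥-elim)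
open import Data.Fin using () renaming (zero to fzero; suc to fsuc)
open import Data.Fin.Properties using (toℕ<n)
open import Data.Fin.Subset using (inside; outside)
open import Data.List using (upTo; filter)
open import Data.List.Extrema.Nat using (argmax; argmax-all; f[xs]≤f[argmax])
open import Data.List.Membership.Propositional using (lose; find)
open import Data.List.Membership.Propositional.Properties using (∈-upTo⁺; ∈-upTo⁻; ∈-filter⁺; ∈-filter⁻)
open import Data.List.Relation.Unary.All as All using (All)
open import Data.List.Relation.Unary.Any.Properties using (any⁺; any⁻)
open import Data.Nat
open import Data.Nat.Coprimality using (prime⇒coprime; coprime-Bézout)
open import Data.Nat.Divisibility using (m%n≡0⇒n∣m; n∣m⇒m%n≡0; *-cancelˡ-∣; m*n∣⇒m∣)
open import Data.Nat.DivMod hiding (_mod_)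
open import Data.Nat.GCD using (module Bézout)
open import Data.Nat.Properties
open import Algebra.Properties.CommutativeSemigroup +-commutativeSemigroup using () renaming (interchange to +-interchange)
open import Data.Nat.Solver using (module +-*-Solver)
open import Data.Product using (∃-syntax; _,_; proj₁; proj₂)
open import Data.Sum as Sum using (_⊎_; inj₁; inj₂)
open import Data.Vec using (Vec; []; _∷_; tabulate; lookup)
open import Data.Vec.Properties using (lookup∘tabulate; []=⇒lookup; lookup⇒[]=)
open import Function using (_∘_)
open import Function.Bundles using (Equivalence)
open import Relation.Binary.PropositionalEquality
open import Relation.Nullary using (¬_; Dec; yes; no; ¬?; _×-dec_)
open import Relation.Nullary.Decidable using (decidable-stable)
open +-*-Solver using (solve; _:+_; _:*_; _:=_; con)

𝟙 : Bool → ℕ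
𝟙 true = 1
𝟙 false = 0

𝟙≤1 : ∀ b → 𝟙 b ≤ 1
𝟙≤1 true = ≤-refl
𝟙≤1 false = z≤n

𝟙-∧ : ∀ b c → 𝟙 (b ∧ c) ≡ 𝟙 b * 𝟙 c
𝟙-∧ true c = sym (+-identityʳ (𝟙 c))
𝟙-∧ false c = refl

∑ : ℕ → (ℕ → ℕ) → ℕ
∑ zero f = 0
∑ (suc n) f = f 0 + ∑ n (f ∘ suc)

syntax ∑ n (λ i → e) = ∑[ i < n ] e

∑-cong : ∀ n {f g} → (∀ {i} → i < n → f i ≡ g i) → ∑ n f ≡ ∑ n g
∑-cong zero eq = refl
∑-cong (suc n) eq = cong₂ _+_ (eq z<s) (∑-cong n (eq ∘ s<s))

∑-mono-≤ : ∀ n {f g} → (∀ {i} → i < n → f i ≤ g i) → ∑ n f ≤ ∑ n g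
∑-mono-≤ zero le = z≤n
∑-mono-≤ (suc n) le = +-mono-≤ (le z<s) (∑-mono-≤ n (le ∘ s<s))

∑-distrib-+ : ∀ n (f g : ℕ → ℕ) → ∑[ i < n ] (f i + g i) ≡ ∑ n f + ∑ n g
∑-distrib-+ zero f g = refl
∑-distrib-+ (suc n) f g = begin
  f 0 + g 0 + ∑[ i < n ] (f (suc i) + g (suc i))  ≡⟨ cong (f 0 + g 0 +_) (∑-distrib-+ n (f ∘ suc) (g ∘ suc)) ⟩
  f 0 + g 0 + (∑ n (f ∘ suc) + ∑ n (g ∘ suc))     ≡⟨ +-interchange (f 0) (g 0) _ _ ⟩
  f 0 + ∑ n (f ∘ suc) + (g 0 + ∑ n (g ∘ suc))     ∎
  where
  open ≡-Reasoning

*-distribˡ-∑ : ∀ n c (f : ℕ → ℕ) → c * ∑ n f ≡ ∑[ i < n ] (c * f i)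
*-distribˡ-∑ zero c f = *-zeroʳ c
*-distribˡ-∑ (suc n) c f = trans (*-distribˡ-+ c (f 0) _) (cong (c * f 0 +_) (*-distribˡ-∑ n c (f ∘ suc)))

∑-const : ∀ n c → ∑[ i < n ] c ≡ n * c
∑-const zero c = refl
∑-const (suc n) c = cong (c +_) (∑-const n c)

∑-zero : ∀ n → ∑[ i < n ] 0 ≡ 0
∑-zero n = trans (∑-const n 0) (*-zeroʳ n)

∑-comm : ∀ m n (f : ℕ → ℕ → ℕ) → ∑[ i < m ] ∑[ j < n ] f i j ≡ ∑[ j < n ] ∑[ i < m ] f i j
∑-comm zero n f = sym (∑-zero n)
∑-comm (suc m) n f = begin
  ∑ n (f 0) + ∑[ i < m ] ∑[ j < n ] f (suc i) j  ≡⟨ cong (∑ n (f 0) +_) (∑-comm m n (f ∘ suc)) ⟩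
  ∑ n (f 0) + ∑[ j < n ] ∑[ i < m ] f (suc i) j  ≡⟨ ∑-distrib-+ n (f 0) _ ⟨
  ∑[ j < n ] ∑[ i < suc m ] f i j                ∎
  where open ≡-Reasoning

∑-init-last : ∀ n f → ∑ (suc n) f ≡ ∑ n f + f n
∑-init-last zero f = +-comm (f 0) 0
∑-init-last (suc n) f = trans (cong (f 0 +_) (∑-init-last n (f ∘ suc))) (sym (+-assoc (f 0) _ _))

term≤∑ : ∀ {n} f {i} → i < n → f i ≤ ∑ n f
term≤∑ f {zero} z<s = m≤m+n (f 0) _
term≤∑ f {suc i} (s<s i<n) = ≤-trans (term≤∑ (f ∘ suc) i<n) (m≤n+m _ (f 0))

∑-positive : ∀ n f → 0 < ∑ n f → ∃[ i ] i < n × 0 < f i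
∑-positive (suc n) f pos with f 0 in eq
... | suc _ = 0 , z<s , subst (0 <_) (sym eq) z<s
... | zero with ∑-positive n (f ∘ suc) pos
... | i , i<n , fi>0 = suc i , s<s i<n , fi>0

∑-point : ∀ n {b} (g : ℕ → ℕ) → b < n → ∑[ i < n ] (𝟙 (i ≡ᵇ b) * g i) ≡ g b
∑-point (suc n) {zero} g _ = trans (cong₂ _+_ (+-identityʳ (g 0)) (∑-zero n)) (+-identityʳ (g 0))
∑-point (suc n) {suc b} g (s<s b<n) = ∑-point n (g ∘ suc) b<n

infix 4 _≡_mod_
_≡_mod_ : ℕ → ℕ → (n : ℕ) → .{{NonZero n}} → Set
x ≡ y mod n = x % n ≡ y % n

0%n≡0 : ∀ n .{{_ : NonZero n}} → 0 % n ≡ 0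
0%n≡0 (suc _) = refl

module Modular (n : ℕ) .{{_ : NonZero n}} where

  %-mod : ∀ x → x % n ≡ x mod n
  %-mod x = m%n%n≡m%n x n

  +-cong-mod : ∀ {a a′ b b′} → a ≡ a′ mod n → b ≡ b′ mod n → a + b ≡ a′ + b′ mod n
  +-cong-mod {a} {a′} {b} {b′} eq₁ eq₂ = begin
    (a + b) % n              ≡⟨ %-distribˡ-+ a b n ⟩
    (a % n + b % n) % n      ≡⟨ cong₂ (λ u v → (u + v) % n) eq₁ eq₂ ⟩
    (a′ % n + b′ % n) % n    ≡⟨ %-distribˡ-+ a′ b′ n ⟨
    (a′ + b′) % n            ∎
    where open ≡-Reasoning

  *-cong-mod : ∀ {a a′ b b′} → a ≡ a′ mod n → b ≡ b′ mod n → a * b ≡ a′ * b′ mod n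
  *-cong-mod {a} {a′} {b} {b′} eq₁ eq₂ = begin
    (a * b) % n              ≡⟨ %-distribˡ-* a b n ⟩
    (a % n * (b % n)) % n    ≡⟨ cong₂ (λ u v → (u * v) % n) eq₁ eq₂ ⟩
    (a′ % n * (b′ % n)) % n  ≡⟨ %-distribˡ-* a′ b′ n ⟨
    (a′ * b′) % n            ∎
    where open ≡-Reasoning

  ≡-mod⇒≡ : ∀ {x y} → x < n → y < n → x ≡ y mod n → x ≡ y
  ≡-mod⇒≡ x<n y<n eq = trans (sym (m<n⇒m%n≡m x<n)) (trans eq (m<n⇒m%n≡m y<n))

  negate : ℕ → ℕ
  negate x = n ∸ x % n

  negate-+ : ∀ x → negate x + x ≡ 0 mod n
  negate-+ x = begin
    (negate x + x) % n      ≡⟨ +-cong-mod {a = negate x} refl (%-mod x) ⟨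
    (n ∸ x % n + x % n) % n   ≡⟨ cong (_% n) (m∸n+n≡m (<⇒≤ (m%n<n x n))) ⟩
    n % n                     ≡⟨ n%n≡0 n ⟩
    0                         ≡⟨ 0%n≡0 n ⟨
    0 % n                     ∎
    where open ≡-Reasoning

  +-cancelˡ-mod : ∀ v {x y} → v + x ≡ v + y mod n → x ≡ y mod n
  +-cancelˡ-mod v {x} {y} eq = begin
    x % n                     ≡⟨ +-cong-mod (negate-+ v) refl ⟨
    (negate v + v + x) % n  ≡⟨ cong (_% n) (+-assoc (negate v) v x) ⟩
    (negate v + (v + x)) % n ≡⟨ +-cong-mod {a = negate v} refl eq ⟩
    (negate v + (v + y)) % n ≡⟨ cong (_% n) (+-assoc (negate v) v y) ⟨
    (negate v + v + y) % n  ≡⟨ +-cong-mod (negate-+ v) refl ⟩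
    y % n                     ∎
    where open ≡-Reasoning

  ∑-cong-mod : ∀ m {f g : ℕ → ℕ} → (∀ {i} → i < m → f i ≡ g i mod n) → ∑ m f ≡ ∑ m g mod n
  ∑-cong-mod zero eq = refl
  ∑-cong-mod (suc m) eq = +-cong-mod (eq z<s) (∑-cong-mod m (eq ∘ s<s))

∑-rotate₁ : ∀ n .{{_ : NonZero n}} (h : ℕ → ℕ) → ∑[ i < n ] h ((i + 1) % n) ≡ ∑ n h
∑-rotate₁ (suc k) h = begin
  ∑[ i < suc k ] h ((i + 1) % suc k)           ≡⟨ ∑-init-last k _ ⟩
  ∑[ i < k ] h ((i + 1) % suc k) + h ((k + 1) % suc k)
    ≡⟨ cong₂ _+_ (∑-cong k (λ {i} i<k → cong h (m<n⇒m%n≡m (subst (_< suc k) (+-comm 1 i) (s<s i<k)))))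
                 (cong h (trans (cong (_% suc k) (+-comm k 1)) (n%n≡0 (suc k)))) ⟩
  ∑[ i < k ] h (i + 1) + h 0                    ≡⟨ +-comm _ (h 0) ⟩
  h 0 + ∑[ i < k ] h (i + 1)                    ≡⟨ cong (h 0 +_) (∑-cong k (λ {i} _ → cong h (+-comm i 1))) ⟩
  ∑ (suc k) h                                   ∎
  where open ≡-Reasoning

∑-rotate : ∀ n .{{_ : NonZero n}} b (g : ℕ → ℕ) → ∑[ i < n ] g ((i + b) % n) ≡ ∑ n g
∑-rotate n zero g = ∑-cong n (λ {i} i<n → cong g (trans (cong (_% n) (+-identityʳ i)) (m<n⇒m%n≡m i<n)))
∑-rotate n (suc b) g = begin
  ∑[ i < n ] g ((i + suc b) % n)            ≡⟨ ∑-cong n (λ {i} _ → cong g (shift i)) ⟩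
  ∑[ i < n ] g (((i + 1) % n + b) % n)      ≡⟨ ∑-rotate₁ n (λ j → g ((j + b) % n)) ⟩
  ∑[ i < n ] g ((i + b) % n)                ≡⟨ ∑-rotate n b g ⟩
  ∑ n g                                     ∎
  where
  open ≡-Reasoning
  open Modular n
  shift : ∀ i → (i + suc b) % n ≡ ((i + 1) % n + b) % n
  shift i = trans (cong (_% n) (sym (+-assoc i 1 b))) (+-cong-mod (sym (%-mod (i + 1))) refl)

any-upTo-intro : ∀ {n} (f : ℕ → Bool) {i} → i < n → f i ≡ true → any f (upTo n) ≡ true
any-upTo-intro f i<n fi = Equivalence.to T-≡ (any⁺ f (lose (∈-upTo⁺ i<n) (Equivalence.from T-≡ fi)))

any-upTo-elim : ∀ n (f : ℕ → Bool) → any f (upTo n) ≡ true → ∃[ i ] i < n × f i ≡ true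
any-upTo-elim n f eq with i , i∈ , fi ← find (any⁻ f (upTo n) (Equivalence.from T-≡ eq)) =
  i , ∈-upTo⁻ i∈ , Equivalence.to T-≡ fi

argmax-on : ∀ n (R : ℕ → Bool) (f : ℕ → ℕ) {a₀} → a₀ < n → R a₀ ≡ true →
            ∃[ a ] a < n × R a ≡ true × (∀ {b} → b < n → R b ≡ true → f b ≤ f a)
argmax-on n R f {a₀} a₀<n Ra₀ = a , proj₁ a∈R , proj₂ a∈R , maximal
  where
  R? = λ b → R b ≟ᵇ true
  candidates = filter R? (upTo n)
  a = argmax f a₀ candidates
  a∈R : a < n × R a ≡ true
  a∈R = argmax-all f (a₀<n , Ra₀) (All.tabulate λ b∈ → let b∈upTo , Rb = ∈-filter⁻ R? b∈ in ∈-upTo⁻ b∈upTo , Rb)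
  maximal : ∀ {b} → b < n → R b ≡ true → f b ≤ f a
  maximal b<n Rb = All.lookup (f[xs]≤f[argmax] a₀ candidates) (∈-filter⁺ R? (∈-upTo⁺ b<n) Rb)

[m/n+1]*n-bracket : ∀ m n .{{_ : NonZero n}} → m < suc (m / n) * n × suc (m / n) * n ≤ m + n
[m/n+1]*n-bracket m n =
  (begin-strict
    m                      ≡⟨ m≡m%n+[m/n]*n m n ⟩
    m % n + m / n * n      <⟨ +-monoˡ-< (m / n * n) (m%n<n m n) ⟩
    n + m / n * n          ∎) ,
  (begin
    n + m / n * n          ≤⟨ +-monoʳ-≤ n (m/n*n≤m m n) ⟩
    n + m                  ≡⟨ +-comm n m ⟩
    m + n                  ∎)
  where open ≤-Reasoning

witness : ∀ {P : ℕ → Set} → Dec (∃ P) → ℕ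
witness (yes (z , _)) = z
witness (no _) = 0

witness-spec : ∀ {P : ℕ → Set} (P? : Dec (∃ P)) → ∃ P → P (witness P?)
witness-spec (yes (_ , Pz)) _ = Pz
witness-spec (no ∄) ∃P = ⊥-elim (∄ ∃P)

halving-step : ∀ N′ T {N r} → N′ + T ≡ N → N ≤ 2 * T → 0 < N → 2 * N ≤ suc r → 2 * N′ ≤ r
halving-step N′ T {N} {r} N′+T≡N N≤2T N>0 2N≤1+r = begin
  2 * N′        ≡⟨ cong (N′ +_) (+-identityʳ N′) ⟩
  N′ + N′       ≤⟨ +-monoʳ-≤ N′ N′≤T ⟩
  N′ + T        ≡⟨ N′+T≡N ⟩
  N             ≤⟨ ≤-pred (begin
    suc N         ≡⟨ +-comm 1 N ⟩
    N + 1         ≤⟨ +-monoʳ-≤ N N>0 ⟩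
    N + N         ≡⟨ cong (N +_) (+-identityʳ N) ⟨
    2 * N         ≤⟨ 2N≤1+r ⟩
    suc r         ∎) ⟩
  r             ∎
  where
  open ≤-Reasoning
  N′≤T : N′ ≤ T
  N′≤T = +-cancelʳ-≤ T N′ T (begin
    N′ + T        ≡⟨ N′+T≡N ⟩
    N             ≤⟨ N≤2T ⟩
    2 * T         ≡⟨ cong (T +_) (+-identityʳ T) ⟩
    T + T         ∎)

quadratic-potential : ∀ n T {P r} → P ≤ 16 * n + suc r * suc r + suc r → suc r ≤ 8 * T →
                      P ≤ 16 * (n + T) + r * r + r
quadratic-potential n T {P} {r} P≤ 1+r≤8T = begin
  P                                       ≤⟨ P≤ ⟩
  16 * n + suc r * suc r + suc r          ≡⟨ solve 2 (λ n r → con 16 :* n :+ (con 1 :+ r) :* (con 1 :+ r) :+ (con 1 :+ r)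
                                                   := con 16 :* n :+ r :* r :+ r :+ con 2 :* (con 1 :+ r)) refl n r ⟩
  16 * n + r * r + r + 2 * suc r          ≤⟨ +-monoʳ-≤ (16 * n + r * r + r) (*-monoʳ-≤ 2 1+r≤8T) ⟩
  16 * n + r * r + r + 2 * (8 * T)        ≡⟨ solve 3 (λ n r t → con 16 :* n :+ r :* r :+ r :+ con 2 :* (con 8 :* t)
                                                   := con 16 :* (n :+ t) :+ r :* r :+ r) refl n r T ⟩
  16 * (n + T) + r * r + r                ∎
  where open ≤-Reasoning

exponential-potential : ∀ n T r j → n ≤ 2 * T → suc r * 2 ^ suc j < 2 * n * 3 ^ suc j →
                        r * 2 ^ j < 2 * (n + T) * 3 ^ j
exponential-potential n T r j n≤2T lt = *-cancelˡ-< 2 _ _ (begin-strict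
  2 * (r * 2 ^ j)               ≡⟨ solve 2 (λ r x → con 2 :* (r :* x) := r :* (con 2 :* x)) refl r (2 ^ j) ⟩
  r * (2 * 2 ^ j)               ≤⟨ *-monoˡ-≤ (2 * 2 ^ j) (n≤1+n r) ⟩
  suc r * (2 * 2 ^ j)           <⟨ lt ⟩
  2 * n * (3 * 3 ^ j)           ≡⟨ solve 2 (λ n x → con 2 :* n :* (con 3 :* x) := con 2 :* ((n :+ con 2 :* n) :* x)) refl n (3 ^ j) ⟩
  2 * ((n + 2 * n) * 3 ^ j)     ≤⟨ *-monoʳ-≤ 2 (*-monoˡ-≤ (3 ^ j) (+-monoˡ-≤ (2 * n) n≤2T)) ⟩
  2 * ((2 * T + 2 * n) * 3 ^ j) ≡⟨ cong (λ t → 2 * (t * 3 ^ j)) (trans (sym (*-distribˡ-+ 2 T n)) (cong (2 *_) (+-comm T n))) ⟩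
  2 * (2 * (n + T) * 3 ^ j)     ∎)
  where open ≤-Reasoning

linear<exponential : ∀ {j} → 10 ≤ j → (5 * j + 2) * 2 ^ j < 2 * 3 ^ j
linear<exponential {j} 10≤j = subst (λ k → (5 * k + 2) * 2 ^ k < 2 * 3 ^ k) (m+[n∸m]≡n 10≤j) (from-10 (j ∸ 10))
  where
  from-10 : ∀ i → (5 * (10 + i) + 2) * 2 ^ (10 + i) < 2 * 3 ^ (10 + i)
  from-10 zero = ≤ᵇ⇒≤ 53249 118098 _
  from-10 (suc i) = begin-strict
    (5 * (11 + i) + 2) * (2 * X) ≡⟨ cong (_* (2 * X)) (solve 1 (λ i → con 5 :* (con 11 :+ i) :+ con 2 := con 5 :* (con 10 :+ i) :+ con 2 :+ con 5) refl i) ⟩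
    (L + 5) * (2 * X)            ≡⟨ solve 2 (λ l x → (l :+ con 5) :* (con 2 :* x) := con 2 :* (l :* x) :+ con 10 :* x) refl L X ⟩
    2 * (L * X) + 10 * X         ≤⟨ +-monoʳ-≤ (2 * (L * X)) (*-monoˡ-≤ X 10≤L) ⟩
    2 * (L * X) + L * X          ≡⟨ solve 2 (λ l x → con 2 :* (l :* x) :+ l :* x := con 3 :* (l :* x)) refl L X ⟩
    3 * (L * X)                  <⟨ *-monoʳ-< 3 (from-10 i) ⟩
    3 * (2 * 3 ^ (10 + i))       ≡⟨ solve 1 (λ y → con 3 :* (con 2 :* y) := con 2 :* (con 3 :* y)) refl (3 ^ (10 + i)) ⟩
    2 * 3 ^ (11 + i)             ∎
    where
    open ≤-Reasoning
    L = 5 * (10 + i) + 2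
    X = 2 ^ (10 + i)
    10≤L : 10 ≤ L
    10≤L = ≤-trans (m≤m+n 10 (42 + 5 * i)) (≤-reflexive (solve 1 (λ i → con 10 :+ (con 42 :+ con 5 :* i) := con 5 :* (con 10 :+ i) :+ con 2) refl i))

c-large : ∀ {c p} → 5 * c + 2 ≤ p → 4 * p ≤ c * c → 21 ≤ c
c-large {c} {p} 5c+2≤p 4p≤c² with 21 ≤? c
... | yes le = le
... | no 21≰c = ⊥-elim (n≮0 (+-cancelˡ-≤ (20 * c) 8 0 (begin
  20 * c + 8             ≡⟨ solve 1 (λ c → con 20 :* c :+ con 8 := con 4 :* (con 5 :* c :+ con 2)) refl c ⟩
  4 * (5 * c + 2)        ≤⟨ *-monoʳ-≤ 4 5c+2≤p ⟩
  4 * p                  ≤⟨ 4p≤c² ⟩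
  c * c                  ≤⟨ *-monoˡ-≤ c (≤-pred (≰⇒> 21≰c)) ⟩
  20 * c                 ≡⟨ +-identityʳ (20 * c) ⟨
  20 * c + 0             ∎)))
  where open ≤-Reasoning

half-bounds : ∀ c → 2 * (c / 2) ≤ c × c ≤ 2 * (c / 2) + 1
half-bounds c =
  ≤-trans (≤-reflexive (*-comm 2 (c / 2))) (m/n*n≤m c 2) ,
  ≤-pred (≤-trans (proj₁ ([m/n+1]*n-bracket c 2)) (≤-reflexive (solve 1 (λ h → (con 1 :+ h) :* con 2 := con 1 :+ (con 2 :* h :+ con 1)) refl (c / 2))))

covering-budget : ∀ {c} → 21 ≤ c → (2 * c + c / 2) * 2 ^ (c / 2) < 2 * 3 ^ (c / 2)
covering-budget {c} 21≤c = begin-strict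
  (2 * c + j) * 2 ^ j      ≤⟨ *-monoˡ-≤ (2 ^ j) (+-monoˡ-≤ j (*-monoʳ-≤ 2 (proj₂ (half-bounds c)))) ⟩
  (2 * (2 * j + 1) + j) * 2 ^ j ≡⟨ cong (_* 2 ^ j) (solve 1 (λ j → con 2 :* (con 2 :* j :+ con 1) :+ j := con 5 :* j :+ con 2) refl j) ⟩
  (5 * j + 2) * 2 ^ j      <⟨ linear<exponential 10≤j ⟩
  2 * 3 ^ j                ∎
  where
  open ≤-Reasoning
  j = c / 2
  10≤j : 10 ≤ j
  10≤j = *-cancelˡ-≤ 2 (≤-pred (≤-trans 21≤c (≤-trans (proj₂ (half-bounds c)) (≤-reflexive (+-comm (2 * j) 1)))))

module Residues (p : ℕ) .{{_ : NonZero p}} where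

  open Modular p public

  infixl 6 _⊕_ _⊖_

  _⊕_ : ℕ → ℕ → ℕ
  x ⊕ b = (x + b) % p

  _⊖_ : ℕ → ℕ → ℕ
  x ⊖ b = x ⊕ negate b

  ⊕<p : ∀ x b → x ⊕ b < p
  ⊕<p x b = m%n<n (x + b) p

  ⊕-mod : ∀ x b → x ⊕ b ≡ x + b mod p
  ⊕-mod x b = %-mod (x + b)

  ⊖-mod : ∀ x b → x ⊖ b ≡ x + negate b mod p
  ⊖-mod x b = ⊕-mod x (negate b)

  ⊕-comm : ∀ x y → x ⊕ y ≡ y ⊕ x
  ⊕-comm x y = cong (_% p) (+-comm x y)

  ⊕-assoc : ∀ x a b → x ⊕ a ⊕ b ≡ x ⊕ (a + b)
  ⊕-assoc x a b = trans (+-cong-mod (⊕-mod x a) refl) (cong (_% p) (+-assoc x a b))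

  ⊕-0-mod : ∀ {x a} → x < p → a ≡ 0 mod p → x ⊕ a ≡ x
  ⊕-0-mod {x} {a} x<p a≡0 = begin
    (x + a) % p  ≡⟨ +-cong-mod {a = x} refl a≡0 ⟩
    (x + 0) % p  ≡⟨ cong (_% p) (+-identityʳ x) ⟩
    x % p        ≡⟨ m<n⇒m%n≡m x<p ⟩
    x            ∎
    where open ≡-Reasoning

  ⊖-⊕ : ∀ {x} b → x < p → x ⊖ b ⊕ b ≡ x
  ⊖-⊕ {x} b x<p = trans (⊕-assoc x (negate b) b) (⊕-0-mod x<p (negate-+ b))

  ⊖-⊕-mod : ∀ x b → x ⊖ b + b ≡ x mod p
  ⊖-⊕-mod x b = begin
    (x ⊖ b + b) % p            ≡⟨ ⊕-assoc x (negate b) b ⟩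
    (x + (negate b + b)) % p   ≡⟨ +-cong-mod {a = x} refl (negate-+ b) ⟩
    (x + 0) % p                ≡⟨ cong (_% p) (+-identityʳ x) ⟩
    x % p                      ∎
    where open ≡-Reasoning

  ⊕-⊖ : ∀ {x} b → x < p → x ⊕ b ⊖ b ≡ x
  ⊕-⊖ {x} b x<p = trans (⊕-assoc x b (negate b)) (⊕-0-mod x<p (trans (cong (_% p) (+-comm b _)) (negate-+ b)))

  ⊖-unique : ∀ {x z} c → z < p → z ⊕ c ≡ x → x ⊖ c ≡ z
  ⊖-unique c z<p refl = ⊕-⊖ c z<p

  ⊕-⊖-cancel : ∀ {x} b → x < p → b ⊕ (x ⊖ b) ≡ x
  ⊕-⊖-cancel {x} b x<p = trans (⊕-comm b (x ⊖ b)) (⊖-⊕ b x<p)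

  ⊕-⊖-swap : ∀ x y z → x ⊕ (y ⊖ z) ≡ y ⊕ (x ⊖ z)
  ⊕-⊖-swap x y z = begin
    (x + (y ⊖ z)) % p           ≡⟨ +-cong-mod {a = x} refl (⊖-mod y z) ⟩
    (x + (y + negate z)) % p    ≡⟨ cong (_% p) (solve 3 (λ x y n → x :+ (y :+ n) := y :+ (x :+ n)) refl x y (negate z)) ⟩
    (y + (x + negate z)) % p    ≡⟨ +-cong-mod {a = y} refl (⊖-mod x z) ⟨
    (y + (x ⊖ z)) % p           ∎
    where open ≡-Reasoning

  ⊖-positive : ∀ {x y} → x < p → y < p → x ≢ y → 0 < x ⊖ y
  ⊖-positive {x} {y} x<p y<p x≢y = n≢0⇒n>0 λ x⊖y≡0 → x≢y (begin
    x              ≡⟨ ⊖-⊕ y x<p ⟨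
    x ⊖ y ⊕ y      ≡⟨ cong (_⊕ y) x⊖y≡0 ⟩
    0 ⊕ y          ≡⟨ m<n⇒m%n≡m y<p ⟩
    y              ∎)
    where open ≡-Reasoning

  ∑-translate : ∀ b (g : ℕ → ℕ) → ∑[ i < p ] g (i ⊕ b) ≡ ∑ p g
  ∑-translate = ∑-rotate p

  -- Sets of residues are Boolean predicates on ℕ; only their values below p are ever used.
  ZSet : Set
  ZSet = ℕ → Bool

  infix 4 _⊆ₚ_
  infixr 7 _∩_
  infixr 6 _∪_ _∖_

  _⊆ₚ_ : ZSet → ZSet → Set
  X ⊆ₚ Y = ∀ {i} → i < p → X i ≡ true → Y i ≡ true

  _∩_ _∪_ _∖_ : ZSet → ZSet → ZSet
  (X ∩ Y) i = X i ∧ Y i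
  (X ∪ Y) i = X i ∨ Y i
  (X ∖ Y) i = X i ∧ not (Y i)

  ∁ : ZSet → ZSet
  ∁ X = not ∘ X

  ｛_｝ : ℕ → ZSet
  ｛ b ｝ i = i ≡ᵇ b

  Disjoint : ZSet → ZSet → Set
  Disjoint S T = ∀ {i} → i < p → S i ≡ true → T i ≡ false

  ∈-｛｝ : ∀ {i b} → ｛ b ｝ i ≡ true → i ≡ b
  ∈-｛｝ {i} {b} eq = ≡ᵇ⇒≡ i b (Equivalence.from T-≡ eq)

  ∉-｛｝ : ∀ {i b} → i ≢ b → ｛ b ｝ i ≡ false
  ∉-｛｝ {i} {b} i≢b with i ≡ᵇ b in eq
  ... | false = refl
  ... | true = ⊥-elim (i≢b (∈-｛｝ eq))

  ∈-∉⇒≢ : ∀ {X : ZSet} {i b} → X i ≡ true → X b ≡ false → i ≢ b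
  ∈-∉⇒≢ i∈X b∉X refl with () ← trans (sym b∉X) i∈X

  ∖｛｝-∌ : ∀ (X : ZSet) b → (X ∖ ｛ b ｝) b ≡ false
  ∖｛｝-∌ X b with b ≡ᵇ b | ≡⇒≡ᵇ b b refl
  ... | true | _ = ∧-zeroʳ (X b)

  ∈-∖｛｝ : ∀ {X : ZSet} {i b} → (X ∖ ｛ b ｝) i ≡ true → i ≢ b
  ∈-∖｛｝ {X} {b = b} i∈ = ∈-∉⇒≢ {X ∖ ｛ b ｝} i∈ (∖｛｝-∌ X b)

  ⊆-trans : ∀ {X Y Z : ZSet} → X ⊆ₚ Y → Y ⊆ₚ Z → X ⊆ₚ Z
  ⊆-trans X⊆Y Y⊆Z i<p i∈X = Y⊆Z i<p (X⊆Y i<p i∈X)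

  ∖-⊆ : ∀ {X Y : ZSet} → X ∖ Y ⊆ₚ X
  ∖-⊆ {X} {i = i} _ = ∧-conicalˡ (X i) _

  ⊆-∪ˡ : ∀ {X Y : ZSet} → X ⊆ₚ X ∪ Y
  ⊆-∪ˡ _ i∈X = cong (_∨ _) i∈X

  ⊆-∪ʳ : ∀ {X Y : ZSet} → Y ⊆ₚ X ∪ Y
  ⊆-∪ʳ {X} {i = i} _ i∈Y = trans (cong (X i ∨_) i∈Y) (∨-zeroʳ (X i))

  ∪-⊆ : ∀ {X Y Z : ZSet} → X ⊆ₚ Z → Y ⊆ₚ Z → X ∪ Y ⊆ₚ Z
  ∪-⊆ {X} X⊆Z Y⊆Z {i} i<p i∈X∪Y with X i in i∈X
  ... | true = X⊆Z i<p i∈X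
  ... | false = Y⊆Z i<p i∈X∪Y

  ｛｝-⊆ : ∀ {Z : ZSet} {b} → Z b ≡ true → ｛ b ｝ ⊆ₚ Z
  ｛｝-⊆ {Z} b∈Z _ i≡b = subst (λ j → Z j ≡ true) (sym (∈-｛｝ i≡b)) b∈Z

  ⊆-∉ : ∀ {X Y : ZSet} {b} → X ⊆ₚ Y → b < p → Y b ≡ false → X b ≡ false
  ⊆-∉ {X} {b = b} X⊆Y b<p b∉Y with X b in b∈X
  ... | false = refl
  ... | true with () ← trans (sym b∉Y) (X⊆Y b<p b∈X)

  ⊆∖⇒Disjoint : ∀ {X Y Z : ZSet} → Y ⊆ₚ Z ∖ X → Disjoint X Y
  ⊆∖⇒Disjoint {X} {Y} {Z} Y⊆Z∖X {i} i<p i∈X = ⊆-∉ Y⊆Z∖X i<p (trans (cong (λ b → Z i ∧ not b) i∈X) (∧-zeroʳ (Z i)))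

  # : ZSet → ℕ
  # X = ∑[ i < p ] 𝟙 (X i)

  #-cong : ∀ {X Y} → (∀ {i} → i < p → X i ≡ Y i) → # X ≡ # Y
  #-cong eq = ∑-cong p (cong 𝟙 ∘ eq)

  #-mono : ∀ {X Y} → X ⊆ₚ Y → # X ≤ # Y
  #-mono {X} {Y} X⊆Y = ∑-mono-≤ p (λ i<p → 𝟙-mono (X⊆Y i<p))
    where
    𝟙-mono : ∀ {a b} → (a ≡ true → b ≡ true) → 𝟙 a ≤ 𝟙 b
    𝟙-mono {false} _ = z≤n
    𝟙-mono {true} a⇒b rewrite a⇒b refl = ≤-refl

  #≤p : ∀ X → # X ≤ p
  #≤p X = ≤-trans (∑-mono-≤ p (λ {i} _ → 𝟙≤1 (X i))) (≤-reflexive (trans (∑-const p 1) (*-identityʳ p)))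

  #-split : ∀ X Y → # X ≡ # (X ∩ Y) + # (X ∖ Y)
  #-split X Y = trans (∑-cong p (λ {i} _ → 𝟙-split (X i) (Y i))) (∑-distrib-+ p _ _)
    where
    𝟙-split : ∀ a b → 𝟙 a ≡ 𝟙 (a ∧ b) + 𝟙 (a ∧ not b)
    𝟙-split false b = refl
    𝟙-split true false = refl
    𝟙-split true true = refl

  #-∪ : ∀ X Y → # (X ∪ Y) ≡ # X + # (Y ∖ X)
  #-∪ X Y = trans (∑-cong p (λ {i} _ → 𝟙-∨ (X i) (Y i))) (∑-distrib-+ p _ _)
    where
    𝟙-∨ : ∀ a b → 𝟙 (a ∨ b) ≡ 𝟙 a + 𝟙 (b ∧ not a)
    𝟙-∨ true b = cong suc (sym (cong 𝟙 (∧-zeroʳ b)))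
    𝟙-∨ false true = refl
    𝟙-∨ false false = refl

  #-∁ : ∀ X → # X + # (∁ X) ≡ p
  #-∁ X = begin
    # X + # (∁ X)                   ≡⟨ ∑-distrib-+ p _ _ ⟨
    ∑[ i < p ] (𝟙 (X i) + 𝟙 (not (X i))) ≡⟨ ∑-cong p (λ {i} _ → 𝟙-not (X i)) ⟩
    ∑[ i < p ] 1                    ≡⟨ ∑-const p 1 ⟩
    p * 1                           ≡⟨ *-identityʳ p ⟩
    p                               ∎
    where
    open ≡-Reasoning
    𝟙-not : ∀ a → 𝟙 a + 𝟙 (not a) ≡ 1
    𝟙-not true = refl
    𝟙-not false = refl

  #-｛｝ : ∀ {b} → b < p → # ｛ b ｝ ≡ 1
  #-｛｝ {b} b<p = trans (∑-cong p (λ {i} _ → sym (*-identityʳ (𝟙 (i ≡ᵇ b))))) (∑-point p (λ _ → 1) b<p)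

  #-all : ∀ {X} → (∀ {i} → i < p → X i ≡ true) → # X ≡ p
  #-all {X} all = trans (∑-cong p (cong 𝟙 ∘ all)) (trans (∑-const p 1) (*-identityʳ p))

  #-positive : ∀ X → 0 < # X → ∃[ i ] i < p × X i ≡ true
  #-positive X pos with ∑-positive p (𝟙 ∘ X) pos
  ... | i , i<p , 𝟙Xi>0 = i , i<p , 𝟙-positive (X i) 𝟙Xi>0
    where
    𝟙-positive : ∀ a → 0 < 𝟙 a → a ≡ true
    𝟙-positive true _ = refl

  #≡0⇒∉ : ∀ X → # X ≡ 0 → ∀ {i} → i < p → X i ≡ false
  #≡0⇒∉ X #X≡0 {i} i<p = 𝟙≤0 (X i) (subst (𝟙 (X i) ≤_) #X≡0 (term≤∑ (𝟙 ∘ X) i<p))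
    where
    𝟙≤0 : ∀ a → 𝟙 a ≤ 0 → a ≡ false
    𝟙≤0 false _ = refl

  #≡p⇒∈ : ∀ X → # X ≡ p → ∀ {i} → i < p → X i ≡ true
  #≡p⇒∈ X #X≡p i<p = trans (sym (not-involutive _)) (cong not (#≡0⇒∉ (∁ X) #∁X≡0 i<p))
    where
    #∁X≡0 : # (∁ X) ≡ 0
    #∁X≡0 = +-cancelˡ-≡ (# X) _ _ (trans (#-∁ X) (trans (sym #X≡p) (sym (+-identityʳ (# X)))))

  ⊆⇒#∩≡ : ∀ {X Y} → Y ⊆ₚ X → # (X ∩ Y) ≡ # Y
  ⊆⇒#∩≡ {X} {Y} Y⊆X = #-cong ∩-⊆
    where
    ∩-⊆ : ∀ {j} → j < p → X j ∧ Y j ≡ Y j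
    ∩-⊆ {j} j<p with Y j in eq
    ... | false = ∧-zeroʳ (X j)
    ... | true = cong (_∧ true) (Y⊆X j<p eq)

  #-remove : ∀ {X b} → b < p → X b ≡ true → # X ≡ suc (# (X ∖ ｛ b ｝))
  #-remove {X} {b} b<p Xb = begin
    # X                              ≡⟨ #-split X ｛ b ｝ ⟩
    # (X ∩ ｛ b ｝) + # (X ∖ ｛ b ｝)   ≡⟨ cong (_+ # (X ∖ ｛ b ｝)) (trans (#-cong (λ {i} _ → ∩-｛｝ i)) (#-｛｝ b<p)) ⟩
    suc (# (X ∖ ｛ b ｝))             ∎
    where
    open ≡-Reasoning
    ∩-｛｝ : ∀ i → X i ∧ (i ≡ᵇ b) ≡ (i ≡ᵇ b)
    ∩-｛｝ i with i ≡ᵇ b in eq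
    ... | false = ∧-zeroʳ (X i)
    ... | true = trans (cong (λ j → X j ∧ true) (∈-｛｝ eq)) (cong (_∧ true) Xb)

  #-< : ∀ {X Y i} → X ⊆ₚ Y → i < p → Y i ≡ true → X i ≡ false → # X < # Y
  #-< {X} {Y} {i} X⊆Y i<p Yi Xi = begin-strict
    # X                      ≡⟨ +-identityʳ (# X) ⟨
    # X + 0                  <⟨ +-monoʳ-< (# X) (≤-trans (≤-reflexive (cong 𝟙 (sym Y∖Xi))) (term≤∑ (𝟙 ∘ (Y ∖ X)) i<p)) ⟩
    # X + # (Y ∖ X)          ≡⟨ cong (_+ # (Y ∖ X)) (⊆⇒#∩≡ X⊆Y) ⟨
    # (Y ∩ X) + # (Y ∖ X)    ≡⟨ #-split Y X ⟨
    # Y                      ∎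
    where
    open ≤-Reasoning
    Y∖Xi : (Y ∖ X) i ≡ true
    Y∖Xi rewrite Yi | Xi = refl

  two-elements : ∀ X → 1 < # X → ∃[ b₀ ] ∃[ b₂ ] b₀ < p × b₂ < p × X b₀ ≡ true × X b₂ ≡ true × b₂ ≢ b₀
  two-elements X #X>1
    with b₀ , b₀<p , b₀∈X ← #-positive X (<-trans z<s #X>1)
    with b₂ , b₂<p , b₂∈X∖b₀ ← #-positive (X ∖ ｛ b₀ ｝) (≤-pred (subst (1 <_) (#-remove b₀<p b₀∈X) #X>1))
    = b₀ , b₂ , b₀<p , b₂<p , b₀∈X , ∧-conicalˡ (X b₂) _ b₂∈X∖b₀ , ∈-∖｛｝ {X} b₂∈X∖b₀

  subset-of-size : ∀ {X} m → m ≤ # X → ∃[ Y ] Y ⊆ₚ X × # Y ≡ m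
  subset-of-size {X} m m≤#X = shrink (# X) X refl m≤#X
    where
    shrink : ∀ n X → # X ≡ n → m ≤ n → ∃[ Y ] Y ⊆ₚ X × # Y ≡ m
    shrink n X #X≡n m≤n with m ≟ n
    ... | yes refl = X , (λ _ i∈X → i∈X) , #X≡n
    shrink zero X #X≡0 m≤0 | no m≢0 = ⊥-elim (m≢0 (n≤0⇒n≡0 m≤0))
    shrink (suc n) X #X≡1+n m≤1+n | no m≢1+n
      with a , a<p , a∈X ← #-positive X (subst (0 <_) (sym #X≡1+n) z<s)
      with Y , Y⊆X∖a , #Y≡m ← shrink n (X ∖ ｛ a ｝) (suc-injective (trans (sym (#-remove a<p a∈X)) #X≡1+n)) (≤-pred (≤∧≢⇒< m≤1+n m≢1+n))
      = Y , (λ i<p i∈Y → ∧-conicalˡ (X _) _ (Y⊆X∖a i<p i∈Y)) , #Y≡m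

  ∑∈ : ZSet → (ℕ → ℕ) → ℕ
  ∑∈ S w = ∑[ i < p ] (𝟙 (S i) * w i)

  syntax ∑∈ S (λ i → e) = ∑[ i ∈ S ] e

  ∑∈-∪ : ∀ {S T} (w : ℕ → ℕ) → Disjoint S T → ∑[ i ∈ S ∪ T ] w i ≡ ∑[ i ∈ S ] w i + ∑[ i ∈ T ] w i
  ∑∈-∪ {S} {T} w disj = trans (∑-cong p (λ i<p → 𝟙-∨ (S _) (T _) (disj i<p))) (∑-distrib-+ p _ _)
    where
    𝟙-∨ : ∀ a b {x} → (a ≡ true → b ≡ false) → 𝟙 (a ∨ b) * x ≡ 𝟙 a * x + 𝟙 b * x
    𝟙-∨ true b {x} a⇒¬b rewrite a⇒¬b refl = sym (+-identityʳ (x + 0))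
    𝟙-∨ false b _ = refl

  ∑∈-｛｝ : ∀ {b} (w : ℕ → ℕ) → b < p → ∑[ i ∈ ｛ b ｝ ] w i ≡ w b
  ∑∈-｛｝ w b<p = ∑-point p w b<p

  ∑∈-cong-mod : ∀ {S} {v w : ℕ → ℕ} →
                (∀ {i} → i < p → S i ≡ true → v i ≡ w i mod p) → ∑[ i ∈ S ] v i ≡ ∑[ i ∈ S ] w i mod p
  ∑∈-cong-mod {S} {v = v} {w} eq = ∑-cong-mod p termwise
    where
    termwise : ∀ {i} → i < p → 𝟙 (S i) * v i ≡ 𝟙 (S i) * w i mod p
    termwise {i} i<p with S i in Si
    ... | false = refl
    ... | true = +-cong-mod (eq i<p Si) refl

  infixl 8 _+ˢ_ _-ˢ_
  infixl 5 _⊞_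

  _+ˢ_ _-ˢ_ : ZSet → ℕ → ZSet
  (X +ˢ e) y = X (y ⊖ e)
  (X -ˢ e) y = X (y ⊕ e)

  #-+ˢ : ∀ X e → # (X +ˢ e) ≡ # X
  #-+ˢ X e = ∑-translate (negate e) (𝟙 ∘ X)

  #--ˢ : ∀ X e → # (X -ˢ e) ≡ # X
  #--ˢ X e = ∑-translate e (𝟙 ∘ X)

  _⊞_ : ZSet → ZSet → ZSet
  (A ⊞ B) y = any (λ b → B b ∧ A (y ⊖ b)) (upTo p)

  ⊞-intro : ∀ {A B : ZSet} y {b} → b < p → B b ≡ true → A (y ⊖ b) ≡ true → (A ⊞ B) y ≡ true
  ⊞-intro y b<p Bb A[y⊖b] = any-upTo-intro _ b<p (cong₂ _∧_ Bb A[y⊖b])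

  ⊞-elim : ∀ {A B : ZSet} y → (A ⊞ B) y ≡ true → ∃[ b ] b < p × B b ≡ true × A (y ⊖ b) ≡ true
  ⊞-elim {A} {B} y eq with b , b<p , Bb∧A ← any-upTo-elim p _ eq =
    b , b<p , ∧-conicalˡ (B b) _ Bb∧A , ∧-conicalʳ (B b) _ Bb∧A

  dyson-# : ∀ A B e → # (A ∪ B +ˢ e) + # (B ∩ A -ˢ e) ≡ # A + # B
  dyson-# A B e = begin
    # (A ∪ B +ˢ e) + # (B ∩ A -ˢ e)              ≡⟨ cong₂ _+_ (#-∪ A (B +ˢ e)) #B′ ⟩
    # A + # (B +ˢ e ∖ A) + # (B +ˢ e ∩ A)       ≡⟨ +-assoc (# A) _ _ ⟩
    # A + (# (B +ˢ e ∖ A) + # (B +ˢ e ∩ A))     ≡⟨ cong (# A +_) (+-comm _ (# (B +ˢ e ∩ A))) ⟩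
    # A + (# (B +ˢ e ∩ A) + # (B +ˢ e ∖ A))     ≡⟨ cong (# A +_) (#-split (B +ˢ e) A) ⟨
    # A + # (B +ˢ e)                             ≡⟨ cong (# A +_) (#-+ˢ B e) ⟩
    # A + # B                                    ∎
    where
    open ≡-Reasoning
    #B′ : # (B ∩ A -ˢ e) ≡ # (B +ˢ e ∩ A)
    #B′ = trans (#-cong (λ {y} y<p → cong (λ z → B z ∧ A (y ⊕ e)) (sym (⊕-⊖ e y<p)))) (#--ˢ (B +ˢ e ∩ A) e)

  dyson-⊞ : ∀ A B e → (A ∪ B +ˢ e) ⊞ (B ∩ A -ˢ e) ⊆ₚ A ⊞ B
  dyson-⊞ A B e {y} y<p y∈ with b , b<p , b∈B′ , y⊖b∈A′ ← ⊞-elim {A ∪ B +ˢ e} {B ∩ A -ˢ e} y y∈ | A (y ⊖ b) in y⊖b∈A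
  ... | true = ⊞-intro {A} {B} y b<p (∧-conicalˡ (B b) _ b∈B′) y⊖b∈A
  ... | false = ⊞-intro {A} {B} y (⊕<p (y ⊖ b) (negate e)) y⊖b∈A′ (subst (λ z → A z ≡ true) (sym key) (∧-conicalʳ (B b) _ b∈B′))
    where
    key : y ⊖ (y ⊖ b ⊖ e) ≡ b ⊕ e
    key = ⊖-unique (y ⊖ b ⊖ e) (⊕<p b e) (≡-mod⇒≡ (⊕<p (b ⊕ e) _) y<p (begin
      (b ⊕ e ⊕ (y ⊖ b ⊖ e)) % p                   ≡⟨ %-mod (b ⊕ e + (y ⊖ b ⊖ e)) ⟩
      (b ⊕ e + (y ⊖ b ⊖ e)) % p                   ≡⟨ +-cong-mod (⊕-mod b e) (trans (⊖-mod (y ⊖ b) e) (+-cong-mod (⊖-mod y b) refl)) ⟩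
      (b + e + (y + negate b + negate e)) % p     ≡⟨ cong (_% p) (solve 5 (λ b e y b′ e′ → b :+ e :+ (y :+ b′ :+ e′) := y :+ (b′ :+ b :+ (e′ :+ e))) refl b e y (negate b) (negate e)) ⟩
      (y + (negate b + b + (negate e + e))) % p   ≡⟨ +-cong-mod {a = y} refl (+-cong-mod (negate-+ b) (negate-+ e)) ⟩
      (y + 0) % p                                 ≡⟨ cong (_% p) (+-identityʳ y) ⟩
      y % p                                       ∎))
      where open ≡-Reasoning

  δ : ZSet → ℕ → ℕ
  δ X b = # (X ∖ X -ˢ b)

  #-∪+ˢ : ∀ X b → # (X ∪ X +ˢ b) ≡ # X + δ X b
  #-∪+ˢ X b = begin
    # (X ∪ X +ˢ b)                  ≡⟨ #-∪ X (X +ˢ b) ⟩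
    # X + # (X +ˢ b ∖ X)            ≡⟨ cong (# X +_) (#--ˢ (X +ˢ b ∖ X) b) ⟨
    # X + # ((X +ˢ b ∖ X) -ˢ b)     ≡⟨ cong (# X +_) (#-cong (λ {y} y<p → cong (λ z → X z ∧ not (X (y ⊕ b))) (⊕-⊖ b y<p))) ⟩
    # X + δ X b                     ∎
    where open ≡-Reasoning

  δ-0 : ∀ X → δ X 0 ≡ 0
  δ-0 X = trans (#-cong (λ {y} y<p → trans (cong (λ z → X y ∧ not (X z)) (⊕-0-mod y<p refl)) (∧-inverseʳ (X y)))) (∑-zero p)

  δ-cong : ∀ X {a b} → a ≡ b mod p → δ X a ≡ δ X b
  δ-cong X a≡b = #-cong (λ {y} _ → cong (λ z → X y ∧ not (X z)) (+-cong-mod {a = y} refl a≡b))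

  δ-subadditive : ∀ X a b → δ X (a + b) ≤ δ X a + δ X b
  δ-subadditive X a b = begin
    δ X (a + b)                                                  ≤⟨ ∑-mono-≤ p (λ {y} _ → 𝟙-∖-trans (X y) (X (y ⊕ a)) (X (y ⊕ a ⊕ b)) (cong X (⊕-assoc y a b))) ⟩
    ∑[ y < p ] (𝟙 (X y ∧ not (X (y ⊕ a))) + 𝟙 (X (y ⊕ a) ∧ not (X (y ⊕ a ⊕ b))))  ≡⟨ ∑-distrib-+ p _ _ ⟩
    δ X a + ∑[ y < p ] 𝟙 (X (y ⊕ a) ∧ not (X (y ⊕ a ⊕ b)))    ≡⟨ cong (δ X a +_) (∑-translate a (λ z → 𝟙 (X z ∧ not (X (z ⊕ b))))) ⟩
    δ X a + δ X b                                                ∎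
    where
    open ≤-Reasoning
    𝟙-∖-trans : ∀ u v w {w′} → w ≡ w′ → 𝟙 (u ∧ not w′) ≤ 𝟙 (u ∧ not v) + 𝟙 (v ∧ not w)
    𝟙-∖-trans true true true refl = z≤n
    𝟙-∖-trans true true false refl = ≤-refl
    𝟙-∖-trans true false w refl = 𝟙≤1 (not w)
    𝟙-∖-trans false v w refl = z≤n

  δ-∁ : ∀ X b → δ (∁ X) b ≡ δ X b
  δ-∁ X b = +-cancelˡ-≡ (# (X ∩ X -ˢ b)) _ _ (begin
    # (X ∩ X -ˢ b) + δ (∁ X) b       ≡⟨ cong₂ _+_ (#-cong (λ {y} _ → ∧-comm (X y) _)) (#-cong (λ {y} _ → ∁∖∁ (X y) _)) ⟩
    # (X -ˢ b ∩ X) + # (X -ˢ b ∖ X)  ≡⟨ #-split (X -ˢ b) X ⟨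
    # (X -ˢ b)                       ≡⟨ #--ˢ X b ⟩
    # X                              ≡⟨ #-split X (X -ˢ b) ⟩
    # (X ∩ X -ˢ b) + δ X b           ∎)
    where
    open ≡-Reasoning
    ∁∖∁ : ∀ u v → not u ∧ not (not v) ≡ v ∧ not u
    ∁∖∁ true v = sym (∧-zeroʳ v)
    ∁∖∁ false v = trans (not-involutive v) (sym (∧-identityʳ v))

  ∑-overlap : ∀ X → ∑[ b < p ] # (X ∩ X -ˢ b) ≡ # X * # X
  ∑-overlap X = begin
    ∑[ b < p ] ∑[ y < p ] 𝟙 (X y ∧ X (y ⊕ b))         ≡⟨ ∑-comm p p _ ⟩
    ∑[ y < p ] ∑[ b < p ] 𝟙 (X y ∧ X (y ⊕ b))         ≡⟨ ∑-cong p (λ {y} _ → inner y) ⟩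
    ∑[ y < p ] (# X * 𝟙 (X y))                        ≡⟨ *-distribˡ-∑ p (# X) (𝟙 ∘ X) ⟨
    # X * # X                                         ∎
    where
    open ≡-Reasoning
    inner : ∀ y → ∑[ b < p ] 𝟙 (X y ∧ X (y ⊕ b)) ≡ # X * 𝟙 (X y)
    inner y = begin
      ∑[ b < p ] 𝟙 (X y ∧ X (y ⊕ b))          ≡⟨ ∑-cong p (λ {b} _ → trans (𝟙-∧ (X y) _) (cong (λ z → 𝟙 (X y) * 𝟙 (X z)) (⊕-comm y b))) ⟩
      ∑[ b < p ] (𝟙 (X y) * 𝟙 (X (b ⊕ y)))    ≡⟨ *-distribˡ-∑ p (𝟙 (X y)) (λ b → 𝟙 (X (b ⊕ y))) ⟨
      𝟙 (X y) * ∑[ b < p ] 𝟙 (X (b ⊕ y))      ≡⟨ cong (𝟙 (X y) *_) (∑-translate y (𝟙 ∘ X)) ⟩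
      𝟙 (X y) * # X                          ≡⟨ *-comm (𝟙 (X y)) (# X) ⟩
      # X * 𝟙 (X y)                          ∎

  markov : ∀ X P S → (∀ {b} → b < p → P b ≡ true → δ X b ≤ S) → # P * (# X ∸ S) ≤ # X * # X
  markov X P S δ≤S = begin
    # P * (# X ∸ S)                     ≡⟨ *-comm (# P) _ ⟩
    (# X ∸ S) * # P                     ≡⟨ *-distribˡ-∑ p (# X ∸ S) (𝟙 ∘ P) ⟩
    ∑[ b < p ] ((# X ∸ S) * 𝟙 (P b))    ≤⟨ ∑-mono-≤ p termwise ⟩
    ∑[ b < p ] # (X ∩ X -ˢ b)           ≡⟨ ∑-overlap X ⟩
    # X * # X                           ∎
    where
    open ≤-Reasoning
    termwise : ∀ {b} → b < p → (# X ∸ S) * 𝟙 (P b) ≤ # (X ∩ X -ˢ b)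
    termwise {b} b<p with P b in Pb
    ... | false = ≤-trans (≤-reflexive (*-zeroʳ (# X ∸ S))) z≤n
    ... | true = begin
      (# X ∸ S) * 1                     ≡⟨ *-identityʳ _ ⟩
      # X ∸ S                           ≤⟨ ∸-monoʳ-≤ (# X) (δ≤S b<p Pb) ⟩
      # X ∸ δ X b                       ≡⟨ cong (_∸ δ X b) (#-split X (X -ˢ b)) ⟩
      # (X ∩ X -ˢ b) + δ X b ∸ δ X b    ≡⟨ m+n∸n≡m _ (δ X b) ⟩
      # (X ∩ X -ˢ b)                    ∎

  markov-half : ∀ {X P S} → 0 < # X → 2 * # X ≤ # P → (∀ {b} → b < p → P b ≡ true → δ X b ≤ S) → # X ≤ 2 * S
  markov-half {X} {P} {S} #X>0 2#X≤#P δ≤S = begin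
    N                  ≤⟨ m≤n+m∸n N S ⟩
    S + (N ∸ S)        ≤⟨ +-monoʳ-≤ S N∸S≤S ⟩
    S + S              ≡⟨ cong (S +_) (+-identityʳ S) ⟨
    2 * S              ∎
    where
    open ≤-Reasoning
    N = # X
    2[N∸S]≤N : 2 * (N ∸ S) ≤ N
    2[N∸S]≤N = *-cancelʳ-≤ (2 * (N ∸ S)) N N {{>-nonZero #X>0}} (begin
      2 * (N ∸ S) * N    ≡⟨ solve 2 (λ d n → con 2 :* d :* n := con 2 :* n :* d) refl (N ∸ S) N ⟩
      2 * N * (N ∸ S)    ≤⟨ *-monoˡ-≤ (N ∸ S) 2#X≤#P ⟩
      # P * (N ∸ S)      ≤⟨ markov X P S δ≤S ⟩
      N * N              ∎)
    N∸S≤S : N ∸ S ≤ S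
    N∸S≤S = +-cancelʳ-≤ (N ∸ S) (N ∸ S) S (begin
      (N ∸ S) + (N ∸ S)  ≡⟨ cong ((N ∸ S) +_) (+-identityʳ (N ∸ S)) ⟨
      2 * (N ∸ S)        ≤⟨ 2[N∸S]≤N ⟩
      N                  ≤⟨ m≤n+m∸n N S ⟩
      S + (N ∸ S)        ∎)

  Covers : ZSet → ZSet → Set
  Covers R X = ∀ {y} → y < p → ∃[ S ] S ⊆ₚ R × ∃[ x ] X x ≡ true × (x + ∑[ i ∈ S ] i ≡ y mod p)

  covers-full : ∀ {R X} → # X ≡ p → Covers R X
  covers-full {X = X} #X≡p {y} y<p = (λ _ → false) , (λ _ ()) , y , #≡p⇒∈ X #X≡p y<p , cong (_% p) (trans (cong (y +_) (∑-zero p)) (+-identityʳ y))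

  covers-step : ∀ {R X a} → a < p → R a ≡ true → Covers (R ∖ ｛ a ｝) (X ∪ X +ˢ a) → Covers R X
  covers-step {R} {X} {a} a<p a∈R covers {y} y<p with S , S⊆R∖a , x , x∈X′ , x+ΣS≡y ← covers y<p | X x in x∈X
  ... | true = S , ⊆-trans {S} S⊆R∖a (∖-⊆ {R} {｛ a ｝}) , x , x∈X , x+ΣS≡y
  ... | false = S ∪ ｛ a ｝ , ∪-⊆ {S} (⊆-trans {S} S⊆R∖a (∖-⊆ {R} {｛ a ｝})) (｛｝-⊆ {R} a∈R) , x ⊖ a , x∈X′ , (begin
    (x ⊖ a + ∑[ i ∈ S ∪ ｛ a ｝ ] i) % p             ≡⟨ cong (λ t → (x ⊖ a + t) % p) (∑∈-∪ (λ i → i) a∉S) ⟩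
    (x ⊖ a + (∑[ i ∈ S ] i + ∑[ i ∈ ｛ a ｝ ] i)) % p ≡⟨ cong (λ t → (x ⊖ a + (∑[ i ∈ S ] i + t)) % p) (∑∈-｛｝ (λ i → i) a<p) ⟩
    (x ⊖ a + (∑[ i ∈ S ] i + a)) % p                ≡⟨ cong (_% p) (solve 3 (λ u s a → u :+ (s :+ a) := u :+ a :+ s) refl (x ⊖ a) _ a) ⟩
    (x ⊖ a + a + ∑[ i ∈ S ] i) % p                  ≡⟨ +-cong-mod (⊖-⊕-mod x a) refl ⟩
    (x + ∑[ i ∈ S ] i) % p                          ≡⟨ x+ΣS≡y ⟩
    y % p                                           ∎)
    where
    open ≡-Reasoning
    a∉S : Disjoint S ｛ a ｝
    a∉S i<p i∈S = ∉-｛｝ (∈-∖｛｝ {R} (S⊆R∖a i<p i∈S))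

inverse-mod : ∀ {p} .{{_ : NonZero p}} → Prime p → ∀ {a} → 0 < a → a < p → ∃[ u ] a * u ≡ 1 mod p
inverse-mod {suc k} p-prime {a} 0<a a<p with coprime-Bézout (prime⇒coprime p-prime {{>-nonZero 0<a}} a<p)
... | Bézout.-+ x y 1+xp≡ya = y , (begin
  (a * y) % p        ≡⟨ cong (_% p) (trans (*-comm a y) (sym 1+xp≡ya)) ⟩
  (1 + x * p) % p    ≡⟨ [m+kn]%n≡m%n 1 x p ⟩
  1 % p              ∎)
  where
  p = suc k
  open ≡-Reasoning
... | Bézout.+- x y 1+ya≡xp = y * k , (begin
  (a * (y * k)) % p            ≡⟨ [m+n]%n≡m%n (a * (y * k)) p ⟨
  (a * (y * k) + p) % p        ≡⟨ cong (_% p) expand ⟩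
  (1 + (x * k) * p) % p        ≡⟨ [m+kn]%n≡m%n 1 (x * k) p ⟩
  1 % p                        ∎)
  where
  p = suc k
  open ≡-Reasoning
  expand : a * (y * k) + p ≡ 1 + (x * k) * p
  expand = begin
    a * (y * k) + suc k     ≡⟨ solve 3 (λ a y k → a :* (y :* k) :+ (con 1 :+ k) := con 1 :+ (con 1 :+ y :* a) :* k) refl a y k ⟩
    1 + (1 + y * a) * k     ≡⟨ cong (λ t → 1 + t * k) 1+ya≡xp ⟩
    1 + x * p * k           ≡⟨ cong (1 +_) (trans (*-assoc x p k) (trans (cong (x *_) (*-comm p k)) (sym (*-assoc x k p)))) ⟩
    1 + (x * k) * p         ∎

module CauchyDavenport (p : ℕ) .{{_ : NonZero p}} (p-prime : Prime p) where

  open Residues p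

  closed⇒full : ∀ {A : ZSet} {a x₀} → 0 < a → a < p → x₀ < p → A x₀ ≡ true →
                (∀ {x} → x < p → A x ≡ true → A (x ⊕ a) ≡ true) → ∀ {y} → y < p → A y ≡ true
  closed⇒full {A} {a} {x₀} 0<a a<p x₀<p Ax₀ closed {y} y<p = subst (λ z → A z ≡ true) reach (orbit ((y ⊖ x₀) * u))
    where
    u = proj₁ (inverse-mod p-prime 0<a a<p)
    au≡1 = proj₂ (inverse-mod p-prime 0<a a<p)
    orbit : ∀ j → A (x₀ ⊕ j * a) ≡ true
    orbit zero = subst (λ z → A z ≡ true) (sym (⊕-0-mod x₀<p refl)) Ax₀
    orbit (suc j) = subst (λ z → A z ≡ true) (trans (⊕-assoc x₀ (j * a) a) (cong (x₀ ⊕_) (+-comm (j * a) a)))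
                      (closed (⊕<p x₀ (j * a)) (orbit j))
    reach : x₀ ⊕ (y ⊖ x₀) * u * a ≡ y
    reach = begin
      (x₀ + w * u * a) % p      ≡⟨ cong (λ t → (x₀ + t) % p) (trans (*-assoc w u a) (cong (w *_) (*-comm u a))) ⟩
      (x₀ + w * (a * u)) % p    ≡⟨ +-cong-mod {a = x₀} refl (*-cong-mod {a = w} refl au≡1) ⟩
      (x₀ + w * 1) % p          ≡⟨ cong (λ t → (x₀ + t) % p) (*-identityʳ w) ⟩
      x₀ ⊕ (y ⊖ x₀)             ≡⟨ ⊕-comm x₀ _ ⟩
      y ⊖ x₀ ⊕ x₀               ≡⟨ ⊖-⊕ x₀ y<p ⟩
      y                         ∎
      where
      open ≡-Reasoning
      w = y ⊖ x₀

  escape : ∀ {A : ZSet} {a} → 0 < a → a < p → 0 < # A → # A < p → ∃[ x ] x < p × A x ≡ true × A (x ⊕ a) ≡ false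
  escape {A} {a} 0<a a<p #A>0 #A<p with # (A ∖ A -ˢ a) in #D
  ... | suc _ with x , x<p , x∈D ← #-positive (A ∖ A -ˢ a) (subst (0 <_) (sym #D) z<s) =
    x , x<p , ∧-conicalˡ (A x) _ x∈D , not-injective (∧-conicalʳ (A x) _ x∈D)
  ... | zero with x₀ , x₀<p , x₀∈A ← #-positive A #A>0 =
    ⊥-elim (<-irrefl (#-all (closed⇒full {A} 0<a a<p x₀<p x₀∈A stays)) #A<p)
    where
    stays : ∀ {x} → x < p → A x ≡ true → A (x ⊕ a) ≡ true
    stays {x} x<p x∈A = not-injective (subst (λ b → b ∧ not (A (x ⊕ a)) ≡ false) x∈A (#≡0⇒∉ (A ∖ A -ˢ a) #D x<p))

  shrinking-transform : ∀ A B → 0 < # A → # A < p → 1 < # B →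
                        ∃[ e ] 0 < # (B ∩ A -ˢ e) × # (B ∩ A -ˢ e) < # B
  shrinking-transform A B #A>0 #A<p #B>1
    with b₀ , b₂ , b₀<p , b₂<p , b₀∈B , b₂∈B , b₂≢b₀ ← two-elements B #B>1
    with x , x<p , x∈A , x⊕a∉A ← escape (⊖-positive b₂<p b₀<p b₂≢b₀) (⊕<p b₂ _) #A>0 #A<p
    = x ⊖ b₀ , ≤-trans (≤-reflexive (cong 𝟙 (sym b₀∈B′))) (term≤∑ (𝟙 ∘ (B ∩ A -ˢ (x ⊖ b₀))) b₀<p) ,
      #-< (λ _ → ∧-conicalˡ (B _) _) b₂<p b₂∈B b₂∉B′
    where
    b₀∈B′ : (B ∩ A -ˢ (x ⊖ b₀)) b₀ ≡ true
    b₀∈B′ = cong₂ _∧_ b₀∈B (subst (λ z → A z ≡ true) (sym (⊕-⊖-cancel b₀ x<p)) x∈A)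
    b₂∉B′ : (B ∩ A -ˢ (x ⊖ b₀)) b₂ ≡ false
    b₂∉B′ = trans (cong (λ z → B b₂ ∧ A z) (⊕-⊖-swap b₂ x b₀)) (trans (cong (B b₂ ∧_) x⊕a∉A) (∧-zeroʳ (B b₂)))

  #≤#⊞ : ∀ {A B : ZSet} {b} → b < p → B b ≡ true → # A ≤ # (A ⊞ B)
  #≤#⊞ {A} {B} {b} b<p b∈B = subst (_≤ # (A ⊞ B)) (#-+ˢ A b) (#-mono (λ {y} _ → ⊞-intro {A} {B} y b<p b∈B))

  cauchy-davenport : ∀ A B → 0 < # A → 0 < # B → p ≤ # (A ⊞ B) ⊎ # A + # B ≤ suc (# (A ⊞ B))
  cauchy-davenport A B = by-size (# B) A B ≤-refl
    where
    by-size : ∀ n A B → # B ≤ n → 0 < # A → 0 < # B → p ≤ # (A ⊞ B) ⊎ # A + # B ≤ suc (# (A ⊞ B))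
    by-size zero A B #B≤0 _ #B>0 = ⊥-elim (<-irrefl refl (<-≤-trans #B>0 #B≤0))
    by-size (suc n) A B #B≤n #A>0 #B>0 with b₀ , b₀<p , b₀∈B ← #-positive B #B>0 | # B ≤? 1 | p ≤? # A
    ... | yes #B≤1 | _ = inj₂ (begin
      # A + # B          ≤⟨ +-monoʳ-≤ (# A) #B≤1 ⟩
      # A + 1            ≡⟨ +-comm (# A) 1 ⟩
      suc (# A)          ≤⟨ s≤s (#≤#⊞ b₀<p b₀∈B) ⟩
      suc (# (A ⊞ B))    ∎)
      where open ≤-Reasoning
    ... | no _ | yes p≤#A = inj₁ (≤-trans p≤#A (#≤#⊞ b₀<p b₀∈B))
    ... | no #B≰1 | no #A≱p = transform (shrinking-transform A B #A>0 (≰⇒> #A≱p) (≰⇒> #B≰1))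
      where
      transform : ∃[ e ] 0 < # (B ∩ A -ˢ e) × # (B ∩ A -ˢ e) < # B → p ≤ # (A ⊞ B) ⊎ # A + # B ≤ suc (# (A ⊞ B))
      transform (e , #B′>0 , #B′<#B) = Sum.map (λ p≤ → ≤-trans p≤ (#-mono (dyson-⊞ A B e))) (λ #A′+#B′≤ → begin
          # A + # B                                  ≡⟨ dyson-# A B e ⟨
          # (A ∪ B +ˢ e) + # (B ∩ A -ˢ e)            ≤⟨ #A′+#B′≤ ⟩
          suc (# ((A ∪ B +ˢ e) ⊞ (B ∩ A -ˢ e)))      ≤⟨ s≤s (#-mono (dyson-⊞ A B e)) ⟩
          suc (# (A ⊞ B))                            ∎)
        (by-size n (A ∪ B +ˢ e) (B ∩ A -ˢ e) (≤-pred (≤-trans #B′<#B #B≤n)) (≤-trans #A>0 (#-mono (⊆-∪ˡ {A} {B +ˢ e}))) #B′>0)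
        where open ≤-Reasoning

module SubsetSumCover (p : ℕ) .{{_ : NonZero p}} (p-prime : Prime p) where

  open Residues p
  open CauchyDavenport p p-prime

  module Multiples {R : ZSet} (R∌0 : R 0 ≡ false) where

    R₀ : ZSet
    R₀ = ｛ 0 ｝ ∪ R

    #R₀ : # R₀ ≡ suc (# R)
    #R₀ = trans (#-∪ ｛ 0 ｝ R) (cong₂ _+_ (#-｛｝ (>-nonZero⁻¹ p)) (#-cong R∖0≡R))
      where
      R∖0≡R : ∀ {i} → i < p → R i ∧ not (i ≡ᵇ 0) ≡ R i
      R∖0≡R {zero} _ = trans (∧-zeroʳ (R 0)) (sym R∌0)
      R∖0≡R {suc i} _ = ∧-identityʳ (R (suc i))

    sums : ℕ → ZSet
    sums zero = R₀
    sums (suc h) = sums h ⊞ R₀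

    #sums : ∀ h → p ≤ # (sums h) ⊎ suc (suc h * # R) ≤ # (sums h)
    #sums zero = inj₂ (≤-reflexive (trans (cong suc (+-identityʳ (# R))) (sym #R₀)))
    #sums (suc h) = grow (#sums h) (cauchy-davenport (sums h) R₀ (#sums>0 (#sums h)) (subst (0 <_) (sym #R₀) z<s))
      where
      #sums>0 : p ≤ # (sums h) ⊎ suc (suc h * # R) ≤ # (sums h) → 0 < # (sums h)
      #sums>0 (inj₁ p≤) = <-≤-trans (>-nonZero⁻¹ p) p≤
      #sums>0 (inj₂ le) = <-≤-trans z<s le
      grow : p ≤ # (sums h) ⊎ suc (suc h * # R) ≤ # (sums h) →
             p ≤ # (sums (suc h)) ⊎ # (sums h) + # R₀ ≤ suc (# (sums (suc h))) →
             p ≤ # (sums (suc h)) ⊎ suc (suc (suc h) * # R) ≤ # (sums (suc h))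
      grow _ (inj₁ p≤) = inj₁ p≤
      grow (inj₁ p≤#F) (inj₂ le) = inj₁ (≤-pred (begin
        suc p                        ≡⟨ +-comm 1 p ⟩
        p + 1                        ≤⟨ +-monoʳ-≤ p (≤-trans (s≤s z≤n) (≤-reflexive (sym #R₀))) ⟩
        p + # R₀                     ≤⟨ +-monoˡ-≤ (# R₀) p≤#F ⟩
        # (sums h) + # R₀            ≤⟨ le ⟩
        suc (# (sums (suc h)))       ∎))
        where open ≤-Reasoning
      grow (inj₂ #F≥) (inj₂ le) = inj₂ (≤-pred (begin
        suc (suc (suc (suc h) * # R))    ≡⟨ cong suc (cong suc (+-comm (# R) _)) ⟩
        suc (suc (suc h * # R + # R))    ≡⟨ cong suc (+-suc (suc h * # R) (# R)) ⟨
        suc (suc h * # R) + suc (# R)    ≡⟨ cong (suc (suc h * # R) +_) (sym #R₀) ⟩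
        suc (suc h * # R) + # R₀         ≤⟨ +-monoˡ-≤ (# R₀) #F≥ ⟩
        # (sums h) + # R₀                ≤⟨ le ⟩
        suc (# (sums (suc h)))           ∎))
        where open ≤-Reasoning

    module _ {Y T} (δ≤T : ∀ {b} → b < p → R b ≡ true → δ Y b ≤ T) where

      δ-R₀ : ∀ {y} → y < p → R₀ y ≡ true → δ Y y ≤ T
      δ-R₀ {y} y<p y∈R₀ with y ≡ᵇ 0 in y≟0
      ... | true = subst (λ z → δ Y z ≤ T) (sym (∈-｛｝ y≟0)) (≤-trans (≤-reflexive (δ-0 Y)) z≤n)
      ... | false = δ≤T y<p y∈R₀

      δ-sums : ∀ h {y} → y < p → sums h y ≡ true → δ Y y ≤ suc h * T
      δ-sums zero y<p y∈ = ≤-trans (δ-R₀ y<p y∈) (≤-reflexive (sym (+-identityʳ T)))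
      δ-sums (suc h) {y} y<p y∈ with b , b<p , b∈R₀ , y⊖b∈F ← ⊞-elim {sums h} {R₀} y y∈ = begin
        δ Y y                      ≡⟨ δ-cong Y (trans (m<n⇒m%n≡m y<p) (sym (⊖-⊕ b y<p))) ⟩
        δ Y (y ⊖ b + b)            ≤⟨ δ-subadditive Y (y ⊖ b) b ⟩
        δ Y (y ⊖ b) + δ Y b        ≤⟨ +-mono-≤ (δ-sums h (⊕<p y _) y⊖b∈F) (δ-R₀ b<p b∈R₀) ⟩
        suc h * T + T              ≡⟨ +-comm (suc h * T) T ⟩
        suc (suc h) * T            ∎
        where open ≤-Reasoning

  -- δ Y is subadditive, so it is at most (h + 1)·T on the (h + 1)-fold sums of R ∪ {0}; by
  -- Cauchy–Davenport these are many, and Markov's inequality for the overlaps then bounds |Y|.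
  growth-bound : ∀ {R Y T} → R 0 ≡ false → (∀ {b} → b < p → R b ≡ true → δ Y b ≤ T) →
                 0 < # Y → 2 * # Y ≤ p → ∀ h → 2 * # Y ≤ suc h * # R → # Y ≤ 2 * (suc h * T)
  growth-bound {R} {Y} R∌0 δ≤T #Y>0 2#Y≤p h 2#Y≤ = markov-half {Y} #Y>0 (2#Y≤#sums (#sums h)) (δ-sums {Y} δ≤T h)
    where
    open Multiples {R} R∌0
    2#Y≤#sums : p ≤ # (sums h) ⊎ suc (suc h * # R) ≤ # (sums h) → 2 * # Y ≤ # (sums h)
    2#Y≤#sums (inj₁ p≤) = ≤-trans 2#Y≤p p≤
    2#Y≤#sums (inj₂ le) = ≤-trans 2#Y≤ (≤-trans (n≤1+n _) le)

  growth-small : ∀ {R Y T} → R 0 ≡ false → (∀ {b} → b < p → R b ≡ true → δ Y b ≤ T) →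
                 0 < # Y → 2 * # Y ≤ # R → # Y ≤ 2 * T
  growth-small {R} {Y} {T} R∌0 δ≤T #Y>0 2#Y≤#R =
    subst (λ t → # Y ≤ 2 * t) (+-identityʳ T)
      (growth-bound R∌0 δ≤T #Y>0 (≤-trans 2#Y≤#R (#≤p R)) 0 (subst (2 * # Y ≤_) (sym (+-identityʳ (# R))) 2#Y≤#R))

  growth-large : ∀ {R Y T} → R 0 ≡ false → (∀ {b} → b < p → R b ≡ true → δ Y b ≤ T) →
                 0 < # R → # R < 2 * # Y → 2 * # Y ≤ p → # R ≤ 8 * T
  growth-large {R} {Y} {T} R∌0 δ≤T #R>0 #R<2#Y 2#Y≤p = *-cancelʳ-≤ r (8 * T) y {{>-nonZero y>0}} (begin
    r * y                      ≤⟨ *-monoʳ-≤ r y≤2HT ⟩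
    r * (2 * (H * T))          ≡⟨ solve 3 (λ r h t → r :* (con 2 :* (h :* t)) := con 2 :* t :* (h :* r)) refl r H T ⟩
    2 * T * (H * r)            ≤⟨ *-monoʳ-≤ (2 * T) Hr≤2y+r ⟩
    2 * T * (2 * y + r)        ≤⟨ *-monoʳ-≤ (2 * T) (+-monoʳ-≤ (2 * y) (<⇒≤ #R<2#Y)) ⟩
    2 * T * (2 * y + 2 * y)    ≡⟨ solve 2 (λ t y → con 2 :* t :* (con 2 :* y :+ con 2 :* y) := con 8 :* t :* y) refl T y ⟩
    8 * T * y                  ∎)
    where
    open ≤-Reasoning
    r = # R
    y = # Y
    y>0 : 0 < y
    y>0 = *-cancelˡ-< 2 0 y (≤-trans (s≤s z≤n) #R<2#Y)
    instance r≢0 = >-nonZero #R>0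
    h = 2 * y / r
    H = suc h
    2y<Hr = proj₁ ([m/n+1]*n-bracket (2 * y) r)
    Hr≤2y+r = proj₂ ([m/n+1]*n-bracket (2 * y) r)
    y≤2HT : y ≤ 2 * (H * T)
    y≤2HT = growth-bound R∌0 δ≤T y>0 2#Y≤p h (<⇒≤ 2y<Hr)

  Greedy : ZSet → ZSet → Set
  Greedy R X = ∃[ a ] a < p × R a ≡ true × (∀ {b} → b < p → R b ≡ true → δ X b ≤ δ X a)

  greedy : ∀ R X → 0 < # R → Greedy R X
  greedy R X #R>0 with a₀ , a₀<p , a₀∈R ← #-positive R #R>0 = argmax-on p R (δ X) a₀<p a₀∈R

  δ-∁-bound : ∀ {R X : ZSet} {T} → (∀ {b} → b < p → R b ≡ true → δ X b ≤ T) → ∀ {b} → b < p → R b ≡ true → δ (∁ X) b ≤ T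
  δ-∁-bound {X = X} δ≤T b<p b∈R = subst (_≤ _) (sym (δ-∁ X _)) (δ≤T b<p b∈R)

  #∁-∪+ˢ : ∀ X a → # (∁ (X ∪ X +ˢ a)) + δ X a ≡ # (∁ X)
  #∁-∪+ˢ X a = +-cancelˡ-≡ (# X) _ _ (begin
    # X + (# (∁ X′) + δ X a)   ≡⟨ solve 3 (λ x y z → x :+ (y :+ z) := x :+ z :+ y) refl (# X) _ _ ⟩
    # X + δ X a + # (∁ X′)     ≡⟨ cong (_+ # (∁ X′)) (#-∪+ˢ X a) ⟨
    # X′ + # (∁ X′)            ≡⟨ #-∁ X′ ⟩
    p                          ≡⟨ #-∁ X ⟨
    # X + # (∁ X)              ∎)
    where
    open ≡-Reasoning
    X′ = X ∪ X +ˢ a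

  2*smaller≤p : ∀ Y Z → # Y ≤ # Z → # Y + # Z ≡ p → 2 * # Y ≤ p
  2*smaller≤p Y Z #Y≤#Z #Y+#Z≡p = begin
    2 * # Y          ≡⟨ cong (# Y +_) (+-identityʳ (# Y)) ⟩
    # Y + # Y        ≤⟨ +-monoʳ-≤ (# Y) #Y≤#Z ⟩
    # Y + # Z        ≡⟨ #Y+#Z≡p ⟩
    p                ∎
    where open ≤-Reasoning

  module Next (R X : ZSet) {a} (R∌0 : R 0 ≡ false) (a<p : a < p) (a∈R : R a ≡ true) {r} (#R≡1+r : # R ≡ suc r) where

    R′ X′ : ZSet
    R′ = R ∖ ｛ a ｝
    X′ = X ∪ X +ˢ a

    R′∌0 : R′ 0 ≡ false
    R′∌0 = cong (_∧ _) R∌0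

    #R′≡r : # R′ ≡ r
    #R′≡r = suc-injective (trans (sym (#-remove a<p a∈R)) #R≡1+r)

  -- The number of missing residues at least halves with every step.
  end-phase : ∀ r R X → R 0 ≡ false → # R ≡ r → 2 * # (∁ X) ≤ r → Covers R X
  end-phase r R X R∌0 #R≡r 2N≤r with # (∁ X) in #∁X≡N
  ... | zero = covers-full (trans (sym (+-identityʳ (# X))) (trans (cong (# X +_) (sym #∁X≡N)) (#-∁ X)))
  end-phase (suc r) R X R∌0 #R≡r 2N≤r | suc N₁ = step (greedy R X (subst (0 <_) (sym #R≡r) z<s))
    where
    step : Greedy R X → Covers R X
    step (a , a<p , a∈R , δ≤δa) = covers-step a<p a∈R
      (end-phase r R′ X′ R′∌0 #R′≡r (halving-step (# (∁ X′)) (δ X a) (trans (#∁-∪+ˢ X a) #∁X≡N) N≤2T z<s 2N≤r))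
      where
      open Next R X R∌0 a<p a∈R #R≡r
      N≤2T : suc N₁ ≤ 2 * δ X a
      N≤2T = subst (_≤ 2 * δ X a) #∁X≡N
               (growth-small R∌0 (δ-∁-bound {R} {X} δ≤δa) (subst (0 <_) (sym #∁X≡N) z<s)
                 (subst (λ n → 2 * n ≤ # R) (sym #∁X≡N) (subst (2 * suc N₁ ≤_) (sym #R≡r) 2N≤r)))

  -- Every step adds at least r/8 residues, so 16·|X| + r² + r does not decrease.
  middle-phase : ∀ r R X → R 0 ≡ false → # R ≡ r → r < 2 * # X → 16 * p ≤ 16 * # X + r * r + r → Covers R X
  middle-phase r R X R∌0 #R≡r r<2n pot with 2 * # (∁ X) ≤? r
  ... | yes 2N≤r = end-phase r R X R∌0 #R≡r 2N≤r
  middle-phase zero R X R∌0 #R≡r r<2n pot | no _ =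
    covers-full (≤-antisym (#≤p X) (*-cancelˡ-≤ 16 (≤-trans pot (≤-reflexive (trans (+-identityʳ _) (+-identityʳ _))))))
  middle-phase (suc r) R X R∌0 #R≡r r<2n pot | no 2N≰r = step (greedy R X #R>0)
    where
    #R>0 : 0 < # R
    #R>0 = subst (0 <_) (sym #R≡r) z<s
    step : Greedy R X → Covers R X
    step (a , a<p , a∈R , δ≤δa) = covers-step a<p a∈R
      (middle-phase r R′ X′ R′∌0 #R′≡r
        (subst (λ n → r < 2 * n) (sym (#-∪+ˢ X a)) (≤-trans (n≤1+n _) (≤-trans r<2n (*-monoʳ-≤ 2 (m≤m+n (# X) (δ X a))))))
        (subst (λ n → 16 * p ≤ 16 * n + r * r + r) (sym (#-∪+ˢ X a)) (quadratic-potential (# X) (δ X a) pot 1+r≤8T)))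
      where
      open Next R X R∌0 a<p a∈R #R≡r
      1+r≤8T : suc r ≤ 8 * δ X a
      1+r≤8T with # X ≤? # (∁ X)
      ... | yes n≤N = subst (_≤ 8 * δ X a) #R≡r
                        (growth-large R∌0 δ≤δa #R>0 (subst (_< 2 * # X) (sym #R≡r) r<2n) (2*smaller≤p X (∁ X) n≤N (#-∁ X)))
      ... | no n≰N = subst (_≤ 8 * δ X a) #R≡r
                        (growth-large R∌0 (δ-∁-bound {R} {X} δ≤δa) #R>0 (subst (_< 2 * # (∁ X)) (sym #R≡r) (≰⇒> 2N≰r))
                          (2*smaller≤p (∁ X) X (<⇒≤ (≰⇒> n≰N)) (trans (+-comm (# (∁ X)) (# X)) (#-∁ X))))

  -- While 2·|X| ≤ r every step multiplies |X| by at least 3/2, so this lasts fewer than j steps.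
  initial-phase : ∀ j r R X → R 0 ≡ false → # R ≡ r → 0 < # X → r * 2 ^ j < 2 * # X * 3 ^ j →
                  16 * p ≤ (r ∸ j) * (r ∸ j) → Covers R X
  initial-phase j r R X R∌0 #R≡r #X>0 exp pot with r <? 2 * # X
  ... | yes r<2n = middle-phase r R X R∌0 #R≡r r<2n (begin
    16 * p                        ≤⟨ pot ⟩
    (r ∸ j) * (r ∸ j)             ≤⟨ *-mono-≤ (m∸n≤m r j) (m∸n≤m r j) ⟩
    r * r                         ≤⟨ m≤n+m (r * r) (16 * # X) ⟩
    16 * # X + r * r              ≤⟨ m≤m+n _ r ⟩
    16 * # X + r * r + r          ∎)
    where open ≤-Reasoning
  initial-phase zero r R X R∌0 #R≡r #X>0 exp pot | no r≮2n =
    ⊥-elim (r≮2n (subst₂ _<_ (*-identityʳ r) (*-identityʳ (2 * # X)) exp))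
  initial-phase (suc j) zero R X R∌0 #R≡r #X>0 exp pot | no r≮2n =
    ⊥-elim (n≮0 (≤-trans (*-monoʳ-≤ 2 #X>0) (≮⇒≥ r≮2n)))
  initial-phase (suc j) (suc r) R X R∌0 #R≡r #X>0 exp pot | no r≮2n = step (greedy R X (subst (0 <_) (sym #R≡r) z<s))
    where
    step : Greedy R X → Covers R X
    step (a , a<p , a∈R , δ≤δa) = covers-step a<p a∈R
      (initial-phase j r R′ X′ R′∌0 #R′≡r
        (≤-trans #X>0 (≤-trans (m≤m+n (# X) (δ X a)) (≤-reflexive (sym (#-∪+ˢ X a)))))
        (subst (λ n → r * 2 ^ j < 2 * n * 3 ^ j) (sym (#-∪+ˢ X a)) (exponential-potential (# X) (δ X a) r j n≤2T exp))
        pot)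
      where
      open Next R X R∌0 a<p a∈R #R≡r
      n≤2T : # X ≤ 2 * δ X a
      n≤2T = growth-small R∌0 δ≤δa #X>0 (subst (2 * # X ≤_) (sym #R≡r) (≮⇒≥ r≮2n))

  subset-sums-cover : ∀ {R} j → R 0 ≡ false → # R * 2 ^ j < 2 * 3 ^ j → 16 * p ≤ (# R ∸ j) * (# R ∸ j) →
                      ∀ {y} → y < p → ∃[ S ] S ⊆ₚ R × (∑[ i ∈ S ] i ≡ y mod p)
  subset-sums-cover {R} j R∌0 exp pot {y} y<p = from-zero (initial-phase j (# R) R ｛ 0 ｝ R∌0 refl (≤-reflexive (sym #｛0｝)) exp′ pot y<p)
    where
    #｛0｝ : # ｛ 0 ｝ ≡ 1
    #｛0｝ = #-｛｝ (>-nonZero⁻¹ p)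
    exp′ : # R * 2 ^ j < 2 * # ｛ 0 ｝ * 3 ^ j
    exp′ = subst (λ n → # R * 2 ^ j < 2 * n * 3 ^ j) (sym #｛0｝) (subst (λ n → # R * 2 ^ j < n * 3 ^ j) (sym (*-identityʳ 2)) exp)
    from-zero : ∃[ S ] S ⊆ₚ R × ∃[ x ] ｛ 0 ｝ x ≡ true × (x + ∑[ i ∈ S ] i ≡ y mod p) → ∃[ S ] S ⊆ₚ R × (∑[ i ∈ S ] i ≡ y mod p)
    from-zero (S , S⊆R , x , x≡0 , x+ΣS≡y) = S , S⊆R , subst (λ x → x + ∑[ i ∈ S ] i ≡ y mod p) (∈-｛｝ x≡0) x+ΣS≡y

module Lifting (p : ℕ) .{{_ : NonZero p}} where

  open Residues p

  WeightCover : (ℕ → ℕ) → ZSet → Set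
  WeightCover w X = ∀ {t} → t < p → ∃[ S ] S ⊆ₚ X × (∑[ i ∈ S ] w i ≡ t mod p)

  module _ (q : ℕ) .{{_ : NonZero q}} (p*-cancel : ∀ x → p * x ≡ 0 mod q → x ≡ 0 mod p)
           (w : ℕ → ℕ) (a₀ : ℕ) {C D : ZSet} {d : ℕ}
           (C-covers : WeightCover w C) (D-covers : WeightCover w D)
           (C∩D≡∅ : Disjoint C D) (d∉C : C d ≡ false) (d∉D : D d ≡ false)
           (d<p : d < p) (d>0 : 0 < d) (wd≡d : w d ≡ d mod p)
         where

    module Q = Modular q

    Solution : Set
    Solution = ∃[ S ] S ⊆ₚ C ∪ D ∪ ｛ d ｝ × ((a₀ + ∑[ i ∈ S ] w i) % p ≡ 0) × ((a₀ + ∑[ i ∈ S ] w i) % q ≢ 0)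

    choose : ∀ {X} → WeightCover w X → ℕ → ZSet
    choose covers t = proj₁ (covers (m%n<n t p))

    choose-⊆ : ∀ {X} (covers : WeightCover w X) t → choose {X} covers t ⊆ₚ X
    choose-⊆ covers t = proj₁ (proj₂ (covers (m%n<n t p)))

    choose-sum : ∀ {X} (covers : WeightCover w X) t → ∑[ i ∈ choose {X} covers t ] w i ≡ t mod p
    choose-sum covers t = trans (proj₂ (proj₂ (covers (m%n<n t p)))) (%-mod t)

    choose-cong : ∀ {X} (covers : WeightCover w X) {t t′} → t ≡ t′ mod p → choose {X} covers t ≡ choose {X} covers t′
    choose-cong covers {t} {t′} t≡t′ = same-residue (m%n<n t p) (m%n<n t′ p) t≡t′
      where
      same-residue : ∀ {r r′} (r<p : r < p) (r′<p : r′ < p) → r ≡ r′ → proj₁ (covers r<p) ≡ proj₁ (covers r′<p)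
      same-residue r<p r′<p refl = cong (λ r<p → proj₁ (covers r<p)) (<-irrelevant r<p r′<p)

    Free : ZSet → Set
    Free E = E ⊆ₚ D ∪ ｛ d ｝

    target : ZSet → ℕ
    target E = negate (a₀ + ∑[ i ∈ E ] w i)

    completion : ZSet → ZSet
    completion E = choose C-covers (target E)

    complete : ZSet → ZSet
    complete E = completion E ∪ E

    Free-avoids-C : ∀ {E} → Free E → Disjoint C E
    Free-avoids-C E-free i<p i∈C = ⊆-∉ E-free i<p (cong₂ _∨_ (C∩D≡∅ i<p i∈C) (∉-｛｝ (∈-∉⇒≢ {C} i∈C d∉C)))

    complete-sum : ∀ {E} → Free E → ∑[ i ∈ complete E ] w i ≡ ∑[ i ∈ completion E ] w i + ∑[ i ∈ E ] w i
    complete-sum {E} E-free = ∑∈-∪ w (λ i<p i∈SC → Free-avoids-C E-free i<p (choose-⊆ C-covers (target E) i<p i∈SC))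

    complete-⊆ : ∀ {E} → Free E → complete E ⊆ₚ C ∪ D ∪ ｛ d ｝
    complete-⊆ {E} E-free = ∪-⊆ {completion E} {E} (⊆-trans {completion E} (choose-⊆ C-covers (target E)) (⊆-∪ˡ {C} {D ∪ ｛ d ｝}))
                                                     (⊆-trans {E} E-free (⊆-∪ʳ {C} {D ∪ ｛ d ｝}))

    complete-≡0-mod-p : ∀ {E} → Free E → (a₀ + ∑[ i ∈ complete E ] w i) % p ≡ 0
    complete-≡0-mod-p {E} E-free = begin
      (a₀ + ∑[ i ∈ complete E ] w i) % p    ≡⟨ cong (λ s → (a₀ + s) % p) (complete-sum E-free) ⟩
      (a₀ + (σC + σE)) % p                  ≡⟨ cong (_% p) (solve 3 (λ a c e → a :+ (c :+ e) := c :+ (a :+ e)) refl a₀ σC σE) ⟩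
      (σC + (a₀ + σE)) % p                  ≡⟨ +-cong-mod (choose-sum C-covers (target E)) refl ⟩
      (target E + (a₀ + σE)) % p            ≡⟨ negate-+ (a₀ + σE) ⟩
      0 % p                                 ≡⟨ 0%n≡0 p ⟩
      0                                     ∎
      where
      open ≡-Reasoning
      σC = ∑[ i ∈ completion E ] w i
      σE = ∑[ i ∈ E ] w i

    Vanishes : ZSet → Set
    Vanishes S = (a₀ + ∑[ i ∈ S ] w i) % q ≡ 0

    lift-unique : ∀ {E E′} → Free E → Free E′ → ∑[ i ∈ E ] w i ≡ ∑[ i ∈ E′ ] w i mod p →
                  Vanishes (complete E) → Vanishes (complete E′) → ∑[ i ∈ E ] w i ≡ ∑[ i ∈ E′ ] w i mod q
    lift-unique {E} {E′} E-free E′-free σE≡σE′ E-vanishes E′-vanishes = Q.+-cancelˡ-mod (a₀ + σC) (begin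
      (a₀ + σC + σE) % q                     ≡⟨ cong (_% q) (+-assoc a₀ σC σE) ⟩
      (a₀ + (σC + σE)) % q                   ≡⟨ cong (λ s → (a₀ + s) % q) (complete-sum E-free) ⟨
      (a₀ + ∑[ i ∈ complete E ] w i) % q     ≡⟨ trans E-vanishes (sym E′-vanishes) ⟩
      (a₀ + ∑[ i ∈ complete E′ ] w i) % q    ≡⟨ cong (λ s → (a₀ + s) % q) (complete-sum E′-free) ⟩
      (a₀ + (σC′ + σE′)) % q                 ≡⟨ cong (λ S → (a₀ + (∑[ i ∈ S ] w i + σE′)) % q) same-completion ⟩
      (a₀ + (σC + σE′)) % q                  ≡⟨ cong (_% q) (+-assoc a₀ σC σE′) ⟨
      (a₀ + σC + σE′) % q                    ∎)
      where
      open ≡-Reasoning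
      σE = ∑[ i ∈ E ] w i
      σE′ = ∑[ i ∈ E′ ] w i
      σC = ∑[ i ∈ completion E ] w i
      σC′ = ∑[ i ∈ completion E′ ] w i
      same-completion : completion E′ ≡ completion E
      same-completion = choose-cong C-covers (cong (λ t → (p ∸ t) % p) (+-cong-mod {a = a₀} refl (sym σE≡σE′)))

    M : ℕ → ZSet
    M j = choose D-covers (j * d)

    M-free : ∀ j → Free (M j)
    M-free j = ⊆-trans {M j} (choose-⊆ D-covers (j * d)) (⊆-∪ˡ {D} {｛ d ｝})

    d∉M : ∀ j → Disjoint (M j) ｛ d ｝
    d∉M j i<p i∈M = ∉-｛｝ (∈-∉⇒≢ {D} (choose-⊆ D-covers (j * d) i<p i∈M) d∉D)

    M+d-free : ∀ j → Free (M j ∪ ｛ d ｝)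
    M+d-free j = ∪-⊆ {M j} {｛ d ｝} (M-free j) (⊆-∪ʳ {D} {｛ d ｝})

    ∑M+d : ∀ j → ∑[ i ∈ M j ∪ ｛ d ｝ ] w i ≡ ∑[ i ∈ M j ] w i + w d
    ∑M+d j = trans (∑∈-∪ w (d∉M j)) (cong (∑[ i ∈ M j ] w i +_) (∑∈-｛｝ w d<p))

    ∑M+d-mod-p : ∀ j → ∑[ i ∈ M j ∪ ｛ d ｝ ] w i ≡ ∑[ i ∈ M (suc j) ] w i mod p
    ∑M+d-mod-p j = begin
      (∑[ i ∈ M j ∪ ｛ d ｝ ] w i) % p     ≡⟨ cong (_% p) (∑M+d j) ⟩
      (∑[ i ∈ M j ] w i + w d) % p         ≡⟨ +-cong-mod (choose-sum D-covers (j * d)) wd≡d ⟩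
      (j * d + d) % p                      ≡⟨ cong (_% p) (+-comm (j * d) d) ⟩
      (suc j * d) % p                      ≡⟨ choose-sum D-covers (suc j * d) ⟨
      (∑[ i ∈ M (suc j) ] w i) % p         ∎
      where open ≡-Reasoning

    BothVanish : ℕ → Set
    BothVanish j = Vanishes (complete (M j ∪ ｛ d ｝)) × Vanishes (complete (M (suc j)))

    module _ (all-vanish : ∀ {j} → j < p → BothVanish j) where

      telescope : ∀ j → j ≤ p → ∑[ i ∈ M j ] w i ≡ ∑[ i ∈ M 0 ] w i + j * w d mod q
      telescope zero _ = cong (_% q) (sym (+-identityʳ _))
      telescope (suc j) 1+j≤p = begin
        (∑[ i ∈ M (suc j) ] w i) % q           ≡⟨ lift-unique (M+d-free j) (M-free (suc j)) (∑M+d-mod-p j) v₁ v₂ ⟨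
        (∑[ i ∈ M j ∪ ｛ d ｝ ] w i) % q        ≡⟨ cong (_% q) (∑M+d j) ⟩
        (∑[ i ∈ M j ] w i + w d) % q            ≡⟨ Q.+-cong-mod (telescope j (≤-trans (n≤1+n j) 1+j≤p)) refl ⟩
        (σ₀ + j * w d + w d) % q                ≡⟨ cong (_% q) (solve 3 (λ s j w → s :+ j :* w :+ w := s :+ (con 1 :+ j) :* w) refl σ₀ j (w d)) ⟩
        (σ₀ + suc j * w d) % q                  ∎
        where
        open ≡-Reasoning
        σ₀ = ∑[ i ∈ M 0 ] w i
        v₁ = proj₁ (all-vanish 1+j≤p)
        v₂ = proj₂ (all-vanish 1+j≤p)

      all-vanish⇒⊥ : ⊥
      all-vanish⇒⊥ = <⇒≢ d>0 (sym (≡-mod⇒≡ d<p (>-nonZero⁻¹ p) (begin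
        d % p          ≡⟨ wd≡d ⟨
        w d % p        ≡⟨ p*-cancel (w d) p*wd≡0 ⟩
        0 % p          ∎)))
        where
        open ≡-Reasoning
        σ₀ = ∑[ i ∈ M 0 ] w i
        Mp≡M0 : M p ≡ M 0
        Mp≡M0 = choose-cong D-covers (trans (cong (_% p) (*-comm p d)) (trans (m*n%n≡0 d p) (sym (0%n≡0 p))))
        p*wd≡0 : p * w d ≡ 0 mod q
        p*wd≡0 = Q.+-cancelˡ-mod σ₀ (begin
          (σ₀ + p * w d) % q                ≡⟨ telescope p ≤-refl ⟨
          (∑[ i ∈ M p ] w i) % q           ≡⟨ cong (λ S → (∑[ i ∈ S ] w i) % q) Mp≡M0 ⟩
          σ₀ % q                            ≡⟨ cong (_% q) (+-identityʳ σ₀) ⟨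
          (σ₀ + 0) % q                      ∎)

    vanishes? : ∀ S → Dec (Vanishes S)
    vanishes? S = (a₀ + ∑[ i ∈ S ] w i) % q ≟ 0

    candidate : ∀ {E} → Free E → ¬ Vanishes (complete E) → Solution
    candidate {E} E-free ¬vanishes = complete E , complete-⊆ E-free , complete-≡0-mod-p E-free , ¬vanishes

    both? : ∀ j → Dec (BothVanish j)
    both? j = vanishes? (complete (M j ∪ ｛ d ｝)) ×-dec vanishes? (complete (M (suc j)))

    lifting : Solution
    lifting with anyUpTo? (¬? ∘ both?) p
    ... | yes (j , _ , ¬both) = counterexample (vanishes? (complete (M j ∪ ｛ d ｝)))
      where
      counterexample : Dec (Vanishes (complete (M j ∪ ｛ d ｝))) → Solution
      counterexample (no ¬v₁) = candidate (M+d-free j) ¬v₁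
      counterexample (yes v₁) = candidate (M-free (suc j)) (λ v₂ → ¬both (v₁ , v₂))
    ... | no none = ⊥-elim (all-vanish⇒⊥ λ {j} j<p → decidable-stable (both? j) λ ¬both → none (j , j<p , ¬both))

infixl 9 _‼_

_‼_ : ∀ {n} → Vec Bool n → ℕ → Bool
[] ‼ _ = false
(b ∷ v) ‼ zero = b
(b ∷ v) ‼ suc i = v ‼ i

‼-lookup : ∀ {n} (v : Vec Bool n) (x : Fin n) → v ‼ toℕ x ≡ lookup v x
‼-lookup (b ∷ v) fzero = refl
‼-lookup (b ∷ v) (fsuc x) = ‼-lookup v x

‼⇒lookup : ∀ {n} (v : Vec Bool n) {i} → v ‼ i ≡ true → ∃[ x ] toℕ x ≡ i × lookup v x ≡ true
‼⇒lookup (b ∷ v) {zero} b≡true = fzero , refl , b≡true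
‼⇒lookup (b ∷ v) {suc i} v‼i with x , x≡i , lookup≡ ← ‼⇒lookup v v‼i = fsuc x , cong suc x≡i , lookup≡

∣∣≡∑‼ : ∀ {n} (v : Vec Bool n) → ∣ v ∣ ≡ ∑[ i < n ] 𝟙 (v ‼ i)
∣∣≡∑‼ [] = refl
∣∣≡∑‼ (true ∷ v) = cong suc (∣∣≡∑‼ v)
∣∣≡∑‼ (false ∷ v) = ∣∣≡∑‼ v

sumFrom-∷ : ∀ {n} off b (t : Subset n) → sumFrom off (b ∷ t) ≡ 𝟙 b * (off + 0) + sumFrom (suc off) t
sumFrom-∷ off true t = cong (_+ sumFrom (suc off) t) (sym (trans (*-identityˡ (off + 0)) (+-identityʳ off)))
sumFrom-∷ off false t = refl

sumFrom-tabulate : ∀ n off (G : ℕ → Bool) → sumFrom off (tabulate {n = n} (G ∘ toℕ)) ≡ ∑[ i < n ] (𝟙 (G i) * (off + i))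
sumFrom-tabulate zero off G = refl
sumFrom-tabulate (suc n) off G = begin
  sumFrom off (tabulate {n = suc n} (G ∘ toℕ))                           ≡⟨ sumFrom-∷ off (G 0) (tabulate (G ∘ suc ∘ toℕ)) ⟩
  𝟙 (G 0) * (off + 0) + sumFrom (suc off) (tabulate {n = n} (G ∘ suc ∘ toℕ)) ≡⟨ cong (_ +_) (sumFrom-tabulate n (suc off) (G ∘ suc)) ⟩
  𝟙 (G 0) * (off + 0) + ∑[ i < n ] (𝟙 (G (suc i)) * (suc off + i))    ≡⟨ cong (_ +_) (∑-cong n (λ {i} _ → cong (𝟙 (G (suc i)) *_) (sym (+-suc off i)))) ⟩
  ∑[ i < suc n ] (𝟙 (G i) * (off + i))                                 ∎
  where open ≡-Reasoning

anyIn⇒∃ : ∀ {m} (f : Fin m → Bool) (B : Subset m) → anyIn f B ≡ true → ∃[ x ] lookup B x ≡ true × f x ≡ true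
anyIn⇒∃ f (inside ∷ B) any with f fzero in f0
... | true = fzero , refl , f0
... | false with x , x∈B , fx ← anyIn⇒∃ (f ∘ fsuc) B any = fsuc x , x∈B , fx
anyIn⇒∃ f (outside ∷ B) any with x , x∈B , fx ← anyIn⇒∃ (f ∘ fsuc) B any = fsuc x , x∈B , fx

p*-cancel : ∀ {p ℓ} .{{_ : NonZero p}} .{{_ : NonZero (p ^ ℓ)}} → 1 < ℓ → ∀ x → p * x ≡ 0 mod p ^ ℓ → x ≡ 0 mod p
p*-cancel {ℓ = suc zero} (s<s ()) 
p*-cancel {p} {suc (suc ℓ)} _ x px≡0 = trans p∣x (sym (0%n≡0 p))
  where
  p∣x = n∣m⇒m%n≡0 x p (m*n∣⇒m∣ p (p ^ ℓ) (*-cancelˡ-∣ p (m%n≡0⇒n∣m (p * x) (p ^ suc (suc ℓ)) (trans px≡0 (0%n≡0 _)))))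

module Representatives (p q : ℕ) .{{_ : NonZero p}} .{{_ : NonZero q}} (B : Subset q) where

  open Residues p

  Red : ZSet
  Red i = reduceMod p B ‼ i

  InClass : ℕ → ℕ → Set
  InClass i z = B ‼ z ≡ true × z % p ≡ i

  class? : ∀ i → Dec (∃[ z ] z < q × InClass i z)
  class? i = anyUpTo? (λ z → (B ‼ z ≟ᵇ true) ×-dec (z % p ≟ i)) q

  rep : ℕ → ℕ
  rep i = witness (class? i)

  reduceMod-lookup : ∀ x → lookup (reduceMod p B) x ≡ true → anyIn (λ b → (toℕ b % p) ≡ᵇ toℕ x) B ≡ true
  reduceMod-lookup x x∈ with anyIn (λ b → (toℕ b % p) ≡ᵇ toℕ x) B | trans (sym (lookup∘tabulate _ x)) x∈
  ... | true | _ = refl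

  Red⇒class : ∀ {i} → Red i ≡ true → ∃[ z ] z < q × InClass i z
  Red⇒class i∈Red with x , refl , x∈ ← ‼⇒lookup (reduceMod p B) i∈Red
                 with b , b∈B , b≡x ← anyIn⇒∃ _ B (reduceMod-lookup x x∈)
    = toℕ b , toℕ<n b , trans (‼-lookup B b) b∈B , ≡ᵇ⇒≡ _ _ (Equivalence.from T-≡ b≡x)

  rep-spec : ∀ {i} → Red i ≡ true → rep i < q × InClass i (rep i)
  rep-spec i∈Red = witness-spec (class? _) (Red⇒class i∈Red)

  Represented : ZSet → Set
  Represented S = ∀ {i} → i < p → S i ≡ true → rep i < q × InClass i (rep i)

  module _ {S : ZSet} (S-reps : Represented S) where

    chosen : ℕ → Bool
    chosen z = S (z % p) ∧ (z ≡ᵇ rep (z % p))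

    lifted : Subset q
    lifted = tabulate (chosen ∘ toℕ)

    lifted⊆B : lifted ⊆ B
    lifted⊆B {x} x∈lifted = lookup⇒[]= x B (trans (sym (‼-lookup B x)) (subst (λ z → B ‼ z ≡ true) (sym z≡rep) rep∈B))
      where
      z = toℕ x
      chosen-z : chosen z ≡ true
      chosen-z = trans (sym (lookup∘tabulate (chosen ∘ toℕ) x)) ([]=⇒lookup x∈lifted)
      z≡rep : z ≡ rep (z % p)
      z≡rep = ∈-｛｝ (∧-conicalʳ (S (z % p)) _ chosen-z)
      rep∈B : B ‼ rep (z % p) ≡ true
      rep∈B = proj₁ (proj₂ (S-reps (m%n<n z p) (∧-conicalˡ (S (z % p)) _ chosen-z)))

    sum-lifted : sumℕ lifted ≡ ∑[ i ∈ S ] rep i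
    sum-lifted = begin
      sumℕ lifted                                              ≡⟨ sumFrom-tabulate q 0 chosen ⟩
      ∑[ z < q ] (𝟙 (chosen z) * z)                            ≡⟨ ∑-cong q (λ {z} _ → fiber z) ⟩
      ∑[ z < q ] ∑[ i < p ] (𝟙 (S i) * (𝟙 (z ≡ᵇ rep i) * z))   ≡⟨ ∑-comm q p _ ⟩
      ∑[ i < p ] ∑[ z < q ] (𝟙 (S i) * (𝟙 (z ≡ᵇ rep i) * z))   ≡⟨ ∑-cong p column ⟩
      ∑[ i < p ] (𝟙 (S i) * rep i)                             ∎
      where
      open ≡-Reasoning
      column : ∀ {i} → i < p → ∑[ z < q ] (𝟙 (S i) * (𝟙 (z ≡ᵇ rep i) * z)) ≡ 𝟙 (S i) * rep i
      column {i} i<p with S i in i∈S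
      ... | false = ∑-zero q
      ... | true = trans (∑-cong q (λ {z} _ → +-identityʳ _)) (trans (∑-point q (λ z → z) (proj₁ (S-reps i<p i∈S))) (sym (+-identityʳ _)))
      fiber : ∀ z → 𝟙 (chosen z) * z ≡ ∑[ i < p ] (𝟙 (S i) * (𝟙 (z ≡ᵇ rep i) * z))
      fiber z = sym (begin
        ∑[ i < p ] (𝟙 (S i) * (𝟙 (z ≡ᵇ rep i) * z))                    ≡⟨ ∑-cong p only-at-residue ⟩
        ∑[ i < p ] (𝟙 (i ≡ᵇ z % p) * (𝟙 (S i) * (𝟙 (z ≡ᵇ rep i) * z)))  ≡⟨ ∑-point p _ (m%n<n z p) ⟩
        𝟙 (S (z % p)) * (𝟙 (z ≡ᵇ rep (z % p)) * z)                    ≡⟨ *-assoc (𝟙 (S (z % p))) _ z ⟨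
        𝟙 (S (z % p)) * 𝟙 (z ≡ᵇ rep (z % p)) * z                      ≡⟨ cong (_* z) (𝟙-∧ (S (z % p)) _) ⟨
        𝟙 (chosen z) * z                                              ∎)
        where
        residue : ∀ {i} → i < p → S i ≡ true → (z ≡ᵇ rep i) ≡ true → z % p ≡ i
        residue i<p i∈S z≟rep = trans (cong (_% p) (∈-｛｝ z≟rep)) (proj₂ (proj₂ (S-reps i<p i∈S)))
        only-at-residue : ∀ {i} → i < p → 𝟙 (S i) * (𝟙 (z ≡ᵇ rep i) * z) ≡ 𝟙 (i ≡ᵇ z % p) * (𝟙 (S i) * (𝟙 (z ≡ᵇ rep i) * z))
        only-at-residue {i} i<p with i ≡ᵇ z % p in i≟z%p | S i in i∈S | z ≡ᵇ rep i in z≟rep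
        ... | true | _ | _ = sym (+-identityʳ _)
        ... | false | false | _ = refl
        ... | false | true | false = refl
        ... | false | true | true with () ← trans (sym i≟z%p) (Equivalence.to T-≡ (≡⇒≡ᵇ i (z % p) (sym (residue i<p i∈S z≟rep))))

module Main (p ℓ : ℕ) .{{_ : NonZero p}} (p-prime : Prime p) (1<ℓ : 1 < ℓ) .{{_ : NonZero (p ^ ℓ)}}
            (c : ℕ) (4p≤c² : 4 * p ≤ c * c) (B : Subset (p ^ ℓ)) (5c+2≤ : 5 * c + 2 ≤ ∣ reduceMod p B ∣)
  where

  q = p ^ ℓ

  open Residues p
  open Representatives p q B
  open SubsetSumCover p p-prime
  open Lifting p

  R : ZSet
  R = Red ∖ ｛ 0 ｝

  R∌0 : R 0 ≡ false
  R∌0 = ∧-zeroʳ (Red 0)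

  #Red : # Red ≡ ∣ reduceMod p B ∣
  #Red = sym (∣∣≡∑‼ (reduceMod p B))

  5c+1≤#R : 5 * c + 1 ≤ # R
  5c+1≤#R = +-cancelˡ-≤ 1 _ _ (begin
    1 + (5 * c + 1)                 ≡⟨ +-comm 1 (5 * c + 1) ⟩
    5 * c + 1 + 1                   ≡⟨ +-assoc (5 * c) 1 1 ⟩
    5 * c + 2                       ≤⟨ 5c+2≤ ⟩
    ∣ reduceMod p B ∣               ≡⟨ #Red ⟨
    # Red                           ≡⟨ #-split Red ｛ 0 ｝ ⟩
    # (Red ∩ ｛ 0 ｝) + # R          ≤⟨ +-monoˡ-≤ (# R) (≤-trans (#-mono (λ _ → ∧-conicalʳ (Red _) _)) (≤-reflexive (#-｛｝ (>-nonZero⁻¹ p)))) ⟩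
    1 + # R                         ∎)
    where open ≤-Reasoning

  21≤c : 21 ≤ c
  21≤c = c-large (≤-trans 5c+2≤ (≤-trans (≤-reflexive (sym #Red)) (#≤p Red))) 4p≤c²

  j m : ℕ
  j = c / 2
  m = 2 * c + j

  2m≤5c : 2 * m ≤ 5 * c
  2m≤5c = begin
    2 * (2 * c + j)     ≡⟨ *-distribˡ-+ 2 (2 * c) j ⟩
    2 * (2 * c) + 2 * j ≤⟨ +-monoʳ-≤ (2 * (2 * c)) (proj₁ (half-bounds c)) ⟩
    2 * (2 * c) + c     ≡⟨ solve 1 (λ c → con 2 :* (con 2 :* c) :+ c := con 5 :* c) refl c ⟩
    5 * c               ∎
    where open ≤-Reasoning

  rep≡id : ∀ {i} → i < p → R i ≡ true → rep i ≡ i mod p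
  rep≡id {i} i<p i∈R = trans (proj₂ (proj₂ (rep-spec (∧-conicalˡ (Red i) _ i∈R)))) (sym (m<n⇒m%n≡m i<p))

  cover : ∀ {X} → X ⊆ₚ R → # X ≡ m → WeightCover rep X
  cover {X} X⊆R #X≡m {t} t<p = reweight (subset-sums-cover j (⊆-∉ X⊆R (>-nonZero⁻¹ p) R∌0) budget potential t<p)
    where
    reweight : ∃[ S ] S ⊆ₚ X × (∑[ i ∈ S ] i ≡ t mod p) → ∃[ S ] S ⊆ₚ X × (∑[ i ∈ S ] rep i ≡ t mod p)
    reweight (S , S⊆X , ΣS≡t) = S , S⊆X , trans (∑∈-cong-mod λ i<p i∈S → rep≡id i<p (X⊆R i<p (S⊆X i<p i∈S))) ΣS≡t
    budget : # X * 2 ^ j < 2 * 3 ^ j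
    budget = subst (λ n → n * 2 ^ j < 2 * 3 ^ j) (sym #X≡m) (covering-budget 21≤c)
    potential : 16 * p ≤ (# X ∸ j) * (# X ∸ j)
    potential = begin
      16 * p                 ≡⟨ *-assoc 4 4 p ⟩
      4 * (4 * p)            ≤⟨ *-monoʳ-≤ 4 4p≤c² ⟩
      4 * (c * c)            ≡⟨ solve 1 (λ c → con 4 :* (c :* c) := (con 2 :* c) :* (con 2 :* c)) refl c ⟩
      (2 * c) * (2 * c)      ≡⟨ cong (λ n → n * n) (trans (sym (m+n∸n≡m (2 * c) j)) (cong (_∸ j) (sym #X≡m))) ⟩
      (# X ∸ j) * (# X ∸ j)  ∎
      where open ≤-Reasoning

  2m≤#R∖d : ∀ {d} → d < p → R d ≡ true → 2 * m ≤ # (R ∖ ｛ d ｝)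
  2m≤#R∖d d<p d∈R = ≤-trans 2m≤5c (≤-pred (≤-trans (≤-reflexive (+-comm 1 (5 * c))) (≤-trans 5c+1≤#R (≤-reflexive (#-remove d<p d∈R)))))

  m≤#rest : ∀ {X C} → C ⊆ₚ X → # C ≡ m → 2 * m ≤ # X → m ≤ # (X ∖ C)
  m≤#rest {X} {C} C⊆X #C≡m 2m≤#X = +-cancelˡ-≤ m m _ (begin
    m + m                  ≡⟨ cong (m +_) (+-identityʳ m) ⟨
    2 * m                  ≤⟨ 2m≤#X ⟩
    # X                    ≡⟨ #-split X C ⟩
    # (X ∩ C) + # (X ∖ C)  ≡⟨ cong (_+ # (X ∖ C)) (trans (⊆⇒#∩≡ C⊆X) #C≡m) ⟩
    m + # (X ∖ C)          ∎)
    where open ≤-Reasoning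

  module _ (a₀ : ℕ) where

    ResidueSolution : Set
    ResidueSolution = ∃[ S ] S ⊆ₚ R × ((a₀ + ∑[ i ∈ S ] rep i) % p ≡ 0) × ((a₀ + ∑[ i ∈ S ] rep i) % q ≢ 0)

    module Split {d} (d<p : d < p) (d∈R : R d ≡ true) {C} (C⊆R∖d : C ⊆ₚ R ∖ ｛ d ｝) (#C≡m : # C ≡ m)
                 {D} (D⊆R∖d∖C : D ⊆ₚ (R ∖ ｛ d ｝) ∖ C) (#D≡m : # D ≡ m) where

      C⊆R : C ⊆ₚ R
      C⊆R = ⊆-trans {C} C⊆R∖d (∖-⊆ {R} {｛ d ｝})

      D⊆R∖d : D ⊆ₚ R ∖ ｛ d ｝
      D⊆R∖d = ⊆-trans {D} D⊆R∖d∖C (∖-⊆ {R ∖ ｛ d ｝} {C})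

      D⊆R : D ⊆ₚ R
      D⊆R = ⊆-trans {D} D⊆R∖d (∖-⊆ {R} {｛ d ｝})

      goal : ResidueSolution
      goal = restrict (lifting q (p*-cancel 1<ℓ) rep a₀ {C} {D} {d} (cover C⊆R #C≡m) (cover D⊆R #D≡m)
                         (⊆∖⇒Disjoint {C} {D} {R ∖ ｛ d ｝} D⊆R∖d∖C) (⊆-∉ {C} C⊆R∖d d<p (∖｛｝-∌ R d)) (⊆-∉ {D} D⊆R∖d d<p (∖｛｝-∌ R d))
                         d<p (n≢0⇒n>0 (∈-∉⇒≢ {R} d∈R R∌0)) (rep≡id d<p d∈R))
        where
        restrict : ∃[ S ] S ⊆ₚ C ∪ D ∪ ｛ d ｝ × ((a₀ + ∑[ i ∈ S ] rep i) % p ≡ 0) × ((a₀ + ∑[ i ∈ S ] rep i) % q ≢ 0) → ResidueSolution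
        restrict (S , S⊆C∪D∪d , ≡0 , ≢0) = S , ⊆-trans {S} S⊆C∪D∪d (∪-⊆ {C} C⊆R (∪-⊆ {D} D⊆R (｛｝-⊆ {R} d∈R))) , ≡0 , ≢0

    residue-solution : ResidueSolution
    residue-solution
      with d , d<p , d∈R ← #-positive R (≤-trans (m≤n+m 1 (5 * c)) 5c+1≤#R)
      with C , C⊆R∖d , #C≡m ← subset-of-size {R ∖ ｛ d ｝} m (≤-trans (m≤m+n m (m + 0)) (2m≤#R∖d d<p d∈R))
      with D , D⊆R∖d∖C , #D≡m ← subset-of-size {(R ∖ ｛ d ｝) ∖ C} m (m≤#rest {R ∖ ｛ d ｝} {C} C⊆R∖d #C≡m (2m≤#R∖d d<p d∈R))
      = Split.goal d<p d∈R {C} C⊆R∖d #C≡m {D} D⊆R∖d∖C #D≡m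



  lift-solution : ∀ a₀ → ResidueSolution a₀ → ∃ λ (A : Subset q) → A ⊆ B × ((a₀ + sumℕ A) % p ≡ 0) × ((a₀ + sumℕ A) % q ≢ 0)
  lift-solution a₀ (S , S⊆R , ≡0 , ≢0) =
    lifted S-reps , lifted⊆B S-reps ,
    subst (λ s → (a₀ + s) % p ≡ 0) (sym (sum-lifted S-reps)) ≡0 ,
    subst (λ s → (a₀ + s) % q ≢ 0) (sym (sum-lifted S-reps)) ≢0
    where
    S-reps : Represented S
    S-reps i<p i∈S = rep-spec (∧-conicalˡ (Red _) _ (S⊆R i<p i∈S))

corollary1p3 : (p ℓ : ℕ) → Prime p → 1 < ℓ
    → let q = p ^ ℓ in
      .{{_ : NonZero p}} → .{{_ : NonZero q}}
    → (c : ℕ) → 4 * p ≤ c * c → (∀ d → 4 * p ≤ d * d → c ≤ d)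
    → (B : Subset q) → 5 * c + 2 ≤ ∣ reduceMod p B ∣
    → (a₀ : Fin q)
    → ∃ λ (A : Subset q) → A ⊆ B
        × ((toℕ a₀ + sumℕ A) % p ≡ 0)
        × ((toℕ a₀ + sumℕ A) % q ≢ 0)
corollary1p3 p ℓ p-prime 1<ℓ c 4p≤c² _ B 5c+2≤ a₀ =
  lift-solution (toℕ a₀) (residue-solution (toℕ a₀))
  where open Main p ℓ p-prime 1<ℓ c 4p≤c² B 5c+2≤
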